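{- For each formula $C$ there is an operator $\mathcal{R}_C$ taking pairs of derivations of $\mathrm{BI}^{\Omega}$ to derivations of $\mathrm{BI}^{\Omega}$ such that for every natural number $m$, every sequent $\Gamma$ and every formula $C$ with $rk(C)\le m$: if $d_0\vdash_m \Gamma, C$ and $d_1\vdash_m \Gamma,\neg C$, then $\mathcal{R}_C(d_0,d_1)\vdash_m \Gamma$.
   Context: Language $L$: terms are built from $0$ by successor $S$; atomic formulas are $R(t_1,\dots,t_n)$ ($R$ a symbol for an $n$-ary primitive recursive relation) and $X(t)$ ($X$ a unary set variable); literals are atomic formulas and their negations. Formulas are built from literals by $\wedge,\vee$, number quantifiers ($\forall xA(x),\exists xA(x)$ are formulas when $A(0)$ is; formulas have no free number variables) and $\forall XA,\exists XA$, allowed only when $A$ has no second-order quantifier and no free set variable other than $X$. Negation of non-atomic formulas is by De Morgan's laws. TRUE is the set of true closed literals $R(\vec n)$, $\neg R(\vec n)$. Rank: $rk(A)=0$ if $A$ is a literal or of the form $\forall XA(X)$ or $\exists XA(X)$; $rk(A\wedge B)=rk(A\vee B)=\max(rk(A),rk(B))+1$; $rk(\forall xA(x))=rk(\exists xA(x))=rk(A(0))+1$. A $\Pi^1$-formula has no subformula of the form $\exists XA(X)$; a $\Pi^1$-sequent is a finite set of $\Pi^1$-formulas. Sequents are finite sets; $\Gamma,A=\Gamma\cup\{A\}$. Derivations: each inference symbol $I$ has principal formulas $\Delta(I)$, index set $|I|$, minor formulas $\Delta_i(I)$ ($i\in|I|$). A derivation $d=I(d_i)_{i\in|I|}$ is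 a well-founded (possibly infinitely branching) labelled tree with end-sequent $\Gamma(d)$ such that $\Delta(I)\subseteq\Gamma(d)$ and $\Gamma(d_i)\subseteq\Gamma(d)\cup\Delta_i(I)$ for all $i$; eigenvariables do not occur free in the conclusion of their inference. $\mathrm{BI}^\Omega_0$ has the rules: $\mathrm{Ax}_\Delta$ (no premises) with $\Delta=\{A\}\subseteq$ TRUE or $\Delta=\{C,\neg C\}$; $\bigwedge_{A_0\wedge A_1}$ (premises $A_0$, $A_1$); $\bigvee^k_{A_0\vee A_1}$, $k\in\{0,1\}$ (premise $A_k$); $\bigwedge_{\forall xA}$ (premises $A(\bar n)$ for all $n\in\omega$); $\bigvee^k_{\exists xA}$, $k\in\omega$ (premise $A(\bar k)$); $\bigwedge_{\forall XA}$ (premise $A(X/Y)$, $Y$ an eigenvariable); $\mathrm{Cut}_A$ ($\Delta=\emptyset$, premises with minor formulas $A$ and $\neg A$); $\mathrm{Rep}$ ($\Delta=\emptyset$, one premise with no minor formula). In each case the principal formula is the displayed conclusion formula. $\mathrm{BI}^\Omega$ adds two rules. Let $|\forall XA(X)|$ be the set of pairs $q=(e,Z)$ where $e$ is a derivation in $\mathrm{BI}^\Omega_0$ containing no Cut, $\Gamma(e)$ is a $\Pi^1$-sequent, $Z$ is a set variable, and $Z$ is not free in $\Delta_q:=\Gamma(e)\setminus\{A(Z)\}$. Rule $\Omega_{\neg\forall XA}$: $\Delta=\{\neg\forall XA\}$, index set $|\forall XA(X)|$, minor formulas $\Delta_q$ for premise $q$. Rule $\widetilde\Omega^Y_{\neg\forall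 XA}$: $\Delta=\emptyset$, index set $\{0\}\cup|\forall XA(X)|$, minor formulas $\{A(Y)\}$ for premise $0$ ($Y$ an eigenvariable) and $\Delta_q$ for premise $q$. Cut-degree: $dg(\mathrm{Cut}_C)=rk(C)+1$, $dg(I)=0$ for all other inference symbols (including $\widetilde\Omega$); $dg(I(d_i)_{i\in|I|})=\sup(\{dg(I)\}\cup\{dg(d_i):i\in|I|\})$. We write $d\vdash_m\Gamma$ if $\Gamma(d)=\Gamma$ and $dg(d)\le m$. -}

module Defs where

open import Data.Nat using (ℕ; zero; suc; _+_; _≤_; _⊔_)
open import Data.Fin using (Fin; punchOut) renaming (zero to fzero; suc to fsuc)
open import Data.Fin.Properties using (_≟_)
open import Data.Vec using (Vec; []; _∷_; lookup)
open import Data.List using (List; _∷_)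
open import Data.List.Membership.Propositional using (_∈_)
open import Data.List.Relation.Binary.Subset.Propositional using (_⊆_)
open import Data.Product using (Σ; _×_; _,_; proj₁; proj₂)
open import Data.Sum using (_⊎_)
open import Data.Empty using (⊥)
open import Data.Unit using (⊤)
open import Relation.Nullary using (¬_; yes; no)
open import Relation.Binary.PropositionalEquality using (_≡_; _≢_)

-- Primitive recursive functions (codes) and their evaluation.
-- An n-ary relation symbol is a code f : PR n; R(x⃗) holds iff f(x⃗) ≢ 0.

data PR : ℕ → Set where
  Zr   : ∀ {n} → PR n
  Sc   : PR 1
  Pj   : ∀ {n} → Fin n → PR n
  Cmp  : ∀ {n k} → PR k → Vec (PR n) k → PR n
  Rec  : ∀ {n} → PR n → PR (suc (suc n)) → PR (suc n)

mutual
  evalPR : ∀ {n} → PR n → Vec ℕ n → ℕ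
  evalPR Zr xs = 0
  evalPR Sc (x ∷ []) = suc x
  evalPR (Pj i) xs = lookup xs i
  evalPR (Cmp f gs) xs = evalPR f (evalPRs gs xs)
  evalPR (Rec g h) (y ∷ xs) = go y
    where
    go : ℕ → ℕ
    go zero = evalPR g xs
    go (suc y′) = evalPR h (y′ ∷ go y′ ∷ xs)

  evalPRs : ∀ {n k} → Vec (PR n) k → Vec ℕ n → Vec ℕ k
  evalPRs [] xs = []
  evalPRs (g ∷ gs) xs = evalPR g xs ∷ evalPRs gs xs

data Tm (n : ℕ) : Set where
  zer : Tm n
  sc  : Tm n → Tm n
  var : Fin n → Tm n

num : ∀ {n} → ℕ → Tm n
num zero = zer
num (suc k) = sc (num k)

evalTm : Tm 0 → ℕ
evalTm zer = 0
evalTm (sc t) = suc (evalTm t)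
evalTm (var ())

evalTms : ∀ {k} → Vec (Tm 0) k → Vec ℕ k
evalTms [] = []
evalTms (t ∷ ts) = evalTm t ∷ evalTms ts

substTm : ∀ {n} → Fin (suc n) → ℕ → Tm (suc n) → Tm n
substTm i k zer = zer
substTm i k (sc t) = sc (substTm i k t)
substTm i k (var j) with i ≟ j
... | yes _ = num k
... | no i≢j = var (punchOut i≢j)

substTms : ∀ {n m} → Fin (suc n) → ℕ → Vec (Tm (suc n)) m → Vec (Tm n) m
substTms i k [] = []
substTms i k (t ∷ ts) = substTm i k t ∷ substTms i k ts

-- Bodies of second-order quantifiers: no second-order quantifier and
-- no free set variable other than the bound one X (atoms xb / nxb).

data Body (n : ℕ) : Set where
  rel  : (k : ℕ) → PR k → Vec (Tm n) k → Body n
  nrel : (k : ℕ) → PR k → Vec (Tm n) k → Body n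
  xb   : Tm n → Body n
  nxb  : Tm n → Body n
  _∧_  : Body n → Body n → Body n
  _∨_  : Body n → Body n → Body n
  all  : Body (suc n) → Body n
  ex   : Body (suc n) → Body n

data Fm (n : ℕ) : Set where
  rel  : (k : ℕ) → PR k → Vec (Tm n) k → Fm n
  nrel : (k : ℕ) → PR k → Vec (Tm n) k → Fm n
  sv   : ℕ → Tm n → Fm n
  nsv  : ℕ → Tm n → Fm n
  _∧_  : Fm n → Fm n → Fm n
  _∨_  : Fm n → Fm n → Fm n
  all  : Fm (suc n) → Fm n
  ex   : Fm (suc n) → Fm n
  allS : Body n → Fm n
  exS  : Body n → Fm n

Formula : Set
Formula = Fm 0

negB : ∀ {n} → Body n → Body n
negB (rel k f ts) = nrel k f ts
negB (nrel k f ts) = rel k f ts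
negB (xb t) = nxb t
negB (nxb t) = xb t
negB (A ∧ B) = negB A ∨ negB B
negB (A ∨ B) = negB A ∧ negB B
negB (all A) = ex (negB A)
negB (ex A) = all (negB A)

neg : ∀ {n} → Fm n → Fm n
neg (rel k f ts) = nrel k f ts
neg (nrel k f ts) = rel k f ts
neg (sv X t) = nsv X t
neg (nsv X t) = sv X t
neg (A ∧ B) = neg A ∨ neg B
neg (A ∨ B) = neg A ∧ neg B
neg (all A) = ex (neg A)
neg (ex A) = all (neg A)
neg (allS A) = exS (negB A)
neg (exS A) = allS (negB A)

inst : ∀ {n} → Body n → ℕ → Fm n
inst (rel k f ts) Y = rel k f ts
inst (nrel k f ts) Y = nrel k f ts
inst (xb t) Y = sv Y t
inst (nxb t) Y = nsv Y t
inst (A ∧ B) Y = inst A Y ∧ inst B Y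
inst (A ∨ B) Y = inst A Y ∨ inst B Y
inst (all A) Y = all (inst A Y)
inst (ex A) Y = ex (inst A Y)

substB : ∀ {n} → Fin (suc n) → ℕ → Body (suc n) → Body n
substB i k (rel m f ts) = rel m f (substTms i k ts)
substB i k (nrel m f ts) = nrel m f (substTms i k ts)
substB i k (xb t) = xb (substTm i k t)
substB i k (nxb t) = nxb (substTm i k t)
substB i k (A ∧ B) = substB i k A ∧ substB i k B
substB i k (A ∨ B) = substB i k A ∨ substB i k B
substB i k (all A) = all (substB (fsuc i) k A)
substB i k (ex A) = ex (substB (fsuc i) k A)

substF : ∀ {n} → Fin (suc n) → ℕ → Fm (suc n) → Fm n
substF i k (rel m f ts) = rel m f (substTms i k ts)
substF i k (nrel m f ts) = nrel m f (substTms i k ts)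
substF i k (sv X t) = sv X (substTm i k t)
substF i k (nsv X t) = nsv X (substTm i k t)
substF i k (A ∧ B) = substF i k A ∧ substF i k B
substF i k (A ∨ B) = substF i k A ∨ substF i k B
substF i k (all A) = all (substF (fsuc i) k A)
substF i k (ex A) = ex (substF (fsuc i) k A)
substF i k (allS A) = allS (substB i k A)
substF i k (exS A) = exS (substB i k A)

_[_] : Fm 1 → ℕ → Formula
A [ k ] = substF fzero k A

rk : ∀ {n} → Fm n → ℕ
rk (rel k f ts) = 0
rk (nrel k f ts) = 0
rk (sv X t) = 0
rk (nsv X t) = 0
rk (A ∧ B) = suc (rk A ⊔ rk B)
rk (A ∨ B) = suc (rk A ⊔ rk B)
rk (all A) = suc (rk A)
rk (ex A) = suc (rk A)
rk (allS A) = 0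
rk (exS A) = 0

Occ : ∀ {n} → ℕ → Fm n → Set
Occ Y (rel k f ts) = ⊥
Occ Y (nrel k f ts) = ⊥
Occ Y (sv X t) = Y ≡ X
Occ Y (nsv X t) = Y ≡ X
Occ Y (A ∧ B) = Occ Y A ⊎ Occ Y B
Occ Y (A ∨ B) = Occ Y A ⊎ Occ Y B
Occ Y (all A) = Occ Y A
Occ Y (ex A) = Occ Y A
Occ Y (allS A) = ⊥
Occ Y (exS A) = ⊥

Pi1 : ∀ {n} → Fm n → Set
Pi1 (A ∧ B) = Pi1 A × Pi1 B
Pi1 (A ∨ B) = Pi1 A × Pi1 B
Pi1 (all A) = Pi1 A
Pi1 (ex A) = Pi1 A
Pi1 (exS A) = ⊥
Pi1 _ = ⊤

TRUE : Formula → Set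
TRUE (rel k f ts) = evalPR f (evalTms ts) ≢ 0
TRUE (nrel k f ts) = evalPR f (evalTms ts) ≡ 0
TRUE _ = ⊥

-- Sequents: finite sets, represented by lists (up to set equality)

Seq : Set
Seq = List Formula

_≋_ : Seq → Seq → Set
Γ ≋ Δ = (Γ ⊆ Δ) × (Δ ⊆ Γ)

Pi1Seq : Seq → Set
Pi1Seq Γ = ∀ {A} → A ∈ Γ → Pi1 A

NotFree : ℕ → Seq → Set
NotFree Y Γ = ∀ {A} → A ∈ Γ → ¬ Occ Y A

-- Derivations of BI^Ω_0 with end-sequent Γ (index).
-- A premise is a derivation of its own end-sequent Δ with
-- Δ ⊆ Γ ∪ (minor formulas).

data Der0 (Γ : Seq) : Set where
  ax     : (A : Formula) → TRUE A → A ∈ Γ → Der0 Γ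
  axC    : (C : Formula) → C ∈ Γ → neg C ∈ Γ → Der0 Γ
  andI   : (A B : Formula) → (A ∧ B) ∈ Γ →
           (Δ₀ : Seq) → Der0 Δ₀ → Δ₀ ⊆ A ∷ Γ →
           (Δ₁ : Seq) → Der0 Δ₁ → Δ₁ ⊆ B ∷ Γ → Der0 Γ
  orI₀   : (A B : Formula) → (A ∨ B) ∈ Γ →
           (Δ : Seq) → Der0 Δ → Δ ⊆ A ∷ Γ → Der0 Γ
  orI₁   : (A B : Formula) → (A ∨ B) ∈ Γ →
           (Δ : Seq) → Der0 Δ → Δ ⊆ B ∷ Γ → Der0 Γ
  allI   : (A : Fm 1) → all A ∈ Γ →
           (Δ : ℕ → Seq) → ((n : ℕ) → Der0 (Δ n)) →
           ((n : ℕ) → Δ n ⊆ (A [ n ]) ∷ Γ) → Der0 Γ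
  exI    : (A : Fm 1) → ex A ∈ Γ → (k : ℕ) →
           (Δ : Seq) → Der0 Δ → Δ ⊆ (A [ k ]) ∷ Γ → Der0 Γ
  allSI  : (A : Body 0) → allS A ∈ Γ → (Y : ℕ) → NotFree Y Γ →
           (Δ : Seq) → Der0 Δ → Δ ⊆ inst A Y ∷ Γ → Der0 Γ
  cut    : (C : Formula) →
           (Δ₀ : Seq) → Der0 Δ₀ → Δ₀ ⊆ C ∷ Γ →
           (Δ₁ : Seq) → Der0 Δ₁ → Δ₁ ⊆ neg C ∷ Γ → Der0 Γ
  rep    : (Δ : Seq) → Der0 Δ → Δ ⊆ Γ → Der0 Γ

CutFree : ∀ {Γ} → Der0 Γ → Set
CutFree (ax A x x₁) = ⊤
CutFree (axC C x x₁) = ⊤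
CutFree (andI A B x Δ₀ d x₁ Δ₁ d₁ x₂) = CutFree d × CutFree d₁
CutFree (orI₀ A B x Δ d x₁) = CutFree d
CutFree (orI₁ A B x Δ d x₁) = CutFree d
CutFree (allI A x Δ ds x₁) = (n : ℕ) → CutFree (ds n)
CutFree (exI A x k Δ d x₁) = CutFree d
CutFree (allSI A x Y x₁ Δ d x₂) = CutFree d
CutFree (cut C Δ₀ d x Δ₁ d₁ x₁) = ⊥
CutFree (rep Δ d x) = CutFree d

-- The index set |∀X A(X)|: pairs q = (e , Z), e a cut-free BI^Ω_0
-- derivation with Π¹ end-sequent, Z not free in Δ_q = Γ(e) \ {A(Z)}.
record Idx (A : Body 0) : Set where
  constructor idx
  field
    endSeq  : Seq
    e       : Der0 endSeq
    cutFree : CutFree e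
    pi1     : Pi1Seq endSeq
    Z       : ℕ
    fresh   : ∀ {B} → B ∈ endSeq → B ≢ inst A Z → ¬ Occ Z B

InΔq : (A : Body 0) → Idx A → Formula → Set
InΔq A q B = (B ∈ Idx.endSeq q) × (B ≢ inst A (Idx.Z q))

SubΔq : (A : Body 0) → Idx A → Seq → Seq → Set
SubΔq A q Δ Γ = ∀ {B} → B ∈ Δ → (B ∈ Γ) ⊎ InΔq A q B

data Der (Γ : Seq) : Set where
  ax     : (A : Formula) → TRUE A → A ∈ Γ → Der Γ
  axC    : (C : Formula) → C ∈ Γ → neg C ∈ Γ → Der Γ
  andI   : (A B : Formula) → (A ∧ B) ∈ Γ →
           (Δ₀ : Seq) → Der Δ₀ → Δ₀ ⊆ A ∷ Γ →
           (Δ₁ : Seq) → Der Δ₁ → Δ₁ ⊆ B ∷ Γ → Der Γ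
  orI₀   : (A B : Formula) → (A ∨ B) ∈ Γ →
           (Δ : Seq) → Der Δ → Δ ⊆ A ∷ Γ → Der Γ
  orI₁   : (A B : Formula) → (A ∨ B) ∈ Γ →
           (Δ : Seq) → Der Δ → Δ ⊆ B ∷ Γ → Der Γ
  allI   : (A : Fm 1) → all A ∈ Γ →
           (Δ : ℕ → Seq) → ((n : ℕ) → Der (Δ n)) →
           ((n : ℕ) → Δ n ⊆ (A [ n ]) ∷ Γ) → Der Γ
  exI    : (A : Fm 1) → ex A ∈ Γ → (k : ℕ) →
           (Δ : Seq) → Der Δ → Δ ⊆ (A [ k ]) ∷ Γ → Der Γ
  allSI  : (A : Body 0) → allS A ∈ Γ → (Y : ℕ) → NotFree Y Γ →
           (Δ : Seq) → Der Δ → Δ ⊆ inst A Y ∷ Γ → Der Γ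
  cut    : (C : Formula) →
           (Δ₀ : Seq) → Der Δ₀ → Δ₀ ⊆ C ∷ Γ →
           (Δ₁ : Seq) → Der Δ₁ → Δ₁ ⊆ neg C ∷ Γ → Der Γ
  rep    : (Δ : Seq) → Der Δ → Δ ⊆ Γ → Der Γ
  omega  : (A : Body 0) → neg (allS A) ∈ Γ →
           (Δ : Idx A → Seq) → ((q : Idx A) → Der (Δ q)) →
           ((q : Idx A) → SubΔq A q (Δ q) Γ) → Der Γ
  omegaT : (A : Body 0) → (Y : ℕ) → NotFree Y Γ →
           (Δ₀ : Seq) → Der Δ₀ → Δ₀ ⊆ inst A Y ∷ Γ →
           (Δ : Idx A → Seq) → ((q : Idx A) → Der (Δ q)) →
           ((q : Idx A) → SubΔq A q (Δ q) Γ) → Der Γ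

DgLe : ℕ → ∀ {Γ} → Der Γ → Set
DgLe m (ax A x x₁) = ⊤
DgLe m (axC C x x₁) = ⊤
DgLe m (andI A B x Δ₀ d x₁ Δ₁ d₁ x₂) = DgLe m d × DgLe m d₁
DgLe m (orI₀ A B x Δ d x₁) = DgLe m d
DgLe m (orI₁ A B x Δ d x₁) = DgLe m d
DgLe m (allI A x Δ ds x₁) = (n : ℕ) → DgLe m (ds n)
DgLe m (exI A x k Δ d x₁) = DgLe m d
DgLe m (allSI A x Y x₁ Δ d x₂) = DgLe m d
DgLe m (cut C Δ₀ d x Δ₁ d₁ x₁) = (suc (rk C) ≤ m) × DgLe m d × DgLe m d₁
DgLe m (rep Δ d x) = DgLe m d
DgLe m (omega A x Δ ds x₁) = (q : Idx A) → DgLe m (ds q)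
DgLe m (omegaT A Y x Δ₀ d x₁ Δ ds x₂) = DgLe m d × ((q : Idx A) → DgLe m (ds q))

Deriv : Set
Deriv = Σ Seq Der

Γ⟨_⟩ : Deriv → Seq
Γ⟨ d ⟩ = proj₁ d

_⊢[_]_ : Deriv → ℕ → Seq → Set
d ⊢[ m ] Γ = (Γ⟨ d ⟩ ≋ Γ) × DgLe m (proj₂ d)

-- Cut reduction by induction on the pair (d₀, d₁), ordered lexicographically. The reduct derives
-- (Γ(d₀) ∖ {C}) ∪ (Γ(d₁) ∖ {¬C}), which is Γ as a set. If the last inference of d₀ does not act
-- on C, it is permuted below the cut, which is pushed into its premises; likewise for ¬C and d₁. If C
-- (or ¬C) belongs to an axiom A, ¬A, the other derivation already proves the reduct up to
-- weakening. Otherwise C and ¬C are both principal: a cut on ∧, ∨, ∀x, ∃x is replaced by cuts on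
-- immediate subformulas, of rank < rk C ≤ m, and ∀X A against its Ω-rule becomes an Ω̃-inference,
-- of degree 0. Eigenvariables of permuted inferences are renamed to fresh ones, so the induction
-- runs along "renamed premise of", which is well founded since renaming preserves the shape of a
-- derivation.

module Submission where

open import Defs
open import Data.Bool using (Bool; true; false; T) renaming (_∧_ to _∧ᵇ_)
open import Data.Bool.Properties using (T-∧; T?)
open import Data.Empty using (⊥; ⊥-elim)
open import Data.Fin using (toℕ)
open import Data.Fin.Properties using (toℕ-injective)
open import Data.List using (List; []; _∷_; _++_; map; foldr; filter; fromMaybe)
open import Data.List.Properties using (foldr-++)
open import Data.List.Membership.Propositional using (_∈_; _∉_)
open import Data.List.Membership.Propositional.Properties
  using (∈-map⁺; ∈-map⁻; ∈-filter⁺; ∈-filter⁻; ∈-++⁺ˡ; ∈-++⁺ʳ; ∈-++⁻)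
open import Data.List.Relation.Binary.Subset.Propositional using (_⊆_)
open import Data.List.Relation.Unary.Any using (here; there; toSum)
open import Data.Maybe using (Maybe; just; nothing)
open import Data.Nat using (ℕ; suc; _≤_; s≤s; _⊔_; _≡ᵇ_)
open import Data.Nat.Properties
  using (≡ᵇ⇒≡; ≡⇒≡ᵇ; ≤-refl; ≤-trans; 1+n≰n; m≤m⊔n; m≤n⊔m; m≤n⇒m≤n⊔o; m≤n⇒m≤o⊔n) renaming (_≟_ to _≟ℕ_)
open import Data.Product using (Σ; _×_; _,_; proj₁; proj₂)
open import Data.Product.Relation.Binary.Lex.Strict using (×-Lex; ×-wellFounded)
open import Data.Sum using (_⊎_; inj₁; inj₂; [_,_]′) renaming (swap to ⊎-swap)
open import Data.Vec using (Vec; []; _∷_)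
open import Function using (Equivalence; _∘_)
open import Function.Definitions using (Injective)
open import Induction.WellFounded using (Acc; acc; WellFounded)
open import Relation.Binary.Definitions using (DecidableEquality)
open import Relation.Binary.PropositionalEquality using (_≡_; _≢_; refl; sym; trans; cong; cong₂; subst)
open import Relation.Nullary using (¬_; yes; no; contradiction)
open import Relation.Nullary.Decidable using (map′; ¬?)

open Equivalence using (to; from)

-- Decidable equality of formulas

T-∧⁻ : ∀ {a b} → T (a ∧ᵇ b) → T a × T b
T-∧⁻ = to T-∧

T-∧⁺ : ∀ {a b} → T a → T b → T (a ∧ᵇ b)
T-∧⁺ p q = from T-∧ (p , q)

cong₂ᵇ : ∀ {A B C : Set} (f : A → B → C) {a b x x′ y y′} →
         (T a → x ≡ x′) → (T b → y ≡ y′) → T (a ∧ᵇ b) → f x y ≡ f x′ y′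
cong₂ᵇ f x≡x′ y≡y′ t = cong₂ f (x≡x′ (proj₁ (T-∧⁻ t))) (y≡y′ (proj₂ (T-∧⁻ t)))

mutual
  PR-eqᵇ : ∀ {n m} → PR n → PR m → Bool
  PR-eqᵇ Zr Zr = true
  PR-eqᵇ Sc Sc = true
  PR-eqᵇ (Pj i) (Pj j) = toℕ i ≡ᵇ toℕ j
  PR-eqᵇ (Cmp {k = k} f gs) (Cmp {k = l} g hs) = (k ≡ᵇ l) ∧ᵇ (PR-eqᵇ f g ∧ᵇ PRs-eqᵇ gs hs)
  PR-eqᵇ (Rec g h) (Rec g′ h′) = PR-eqᵇ g g′ ∧ᵇ PR-eqᵇ h h′
  PR-eqᵇ _ _ = false

  PRs-eqᵇ : ∀ {n m k l} → Vec (PR n) k → Vec (PR m) l → Bool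
  PRs-eqᵇ [] [] = true
  PRs-eqᵇ (f ∷ fs) (g ∷ gs) = PR-eqᵇ f g ∧ᵇ PRs-eqᵇ fs gs
  PRs-eqᵇ _ _ = false

mutual
  PR-eqᵇ-sound : ∀ {n} (f g : PR n) → T (PR-eqᵇ f g) → f ≡ g
  PR-eqᵇ-sound Zr Zr _ = refl
  PR-eqᵇ-sound Sc Sc _ = refl
  PR-eqᵇ-sound (Pj i) (Pj j) = cong Pj ∘ toℕ-injective ∘ ≡ᵇ⇒≡ _ _
  PR-eqᵇ-sound (Cmp {k = k} f gs) (Cmp {k = l} g hs) p with T-∧⁻ p
  ... | k≡l , q with ≡ᵇ⇒≡ k l k≡l
  ...   | refl = cong₂ᵇ Cmp (PR-eqᵇ-sound f g) (PRs-eqᵇ-sound gs hs) q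
  PR-eqᵇ-sound (Rec g h) (Rec g′ h′) = cong₂ᵇ Rec (PR-eqᵇ-sound g g′) (PR-eqᵇ-sound h h′)

  PRs-eqᵇ-sound : ∀ {n k} (fs gs : Vec (PR n) k) → T (PRs-eqᵇ fs gs) → fs ≡ gs
  PRs-eqᵇ-sound [] [] _ = refl
  PRs-eqᵇ-sound (f ∷ fs) (g ∷ gs) = cong₂ᵇ _∷_ (PR-eqᵇ-sound f g) (PRs-eqᵇ-sound fs gs)

mutual
  PR-eqᵇ-refl : ∀ {n} (f : PR n) → T (PR-eqᵇ f f)
  PR-eqᵇ-refl Zr = _
  PR-eqᵇ-refl Sc = _
  PR-eqᵇ-refl (Pj i) = ≡⇒≡ᵇ (toℕ i) _ refl
  PR-eqᵇ-refl (Cmp {k = k} f gs) = T-∧⁺ (≡⇒≡ᵇ k k refl) (T-∧⁺ (PR-eqᵇ-refl f) (PRs-eqᵇ-refl gs))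
  PR-eqᵇ-refl (Rec g h) = T-∧⁺ (PR-eqᵇ-refl g) (PR-eqᵇ-refl h)

  PRs-eqᵇ-refl : ∀ {n k} (fs : Vec (PR n) k) → T (PRs-eqᵇ fs fs)
  PRs-eqᵇ-refl [] = _
  PRs-eqᵇ-refl (f ∷ fs) = T-∧⁺ (PR-eqᵇ-refl f) (PRs-eqᵇ-refl fs)

Tm-eqᵇ : ∀ {n} → Tm n → Tm n → Bool
Tm-eqᵇ zer zer = true
Tm-eqᵇ (sc s) (sc t) = Tm-eqᵇ s t
Tm-eqᵇ (var i) (var j) = toℕ i ≡ᵇ toℕ j
Tm-eqᵇ _ _ = false

Tm-eqᵇ-sound : ∀ {n} (s t : Tm n) → T (Tm-eqᵇ s t) → s ≡ t
Tm-eqᵇ-sound zer zer _ = refl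
Tm-eqᵇ-sound (sc s) (sc t) = cong sc ∘ Tm-eqᵇ-sound s t
Tm-eqᵇ-sound (var i) (var j) = cong var ∘ toℕ-injective ∘ ≡ᵇ⇒≡ _ _

Tm-eqᵇ-refl : ∀ {n} (t : Tm n) → T (Tm-eqᵇ t t)
Tm-eqᵇ-refl zer = _
Tm-eqᵇ-refl (sc t) = Tm-eqᵇ-refl t
Tm-eqᵇ-refl (var i) = ≡⇒≡ᵇ (toℕ i) _ refl

Tms-eqᵇ : ∀ {n k l} → Vec (Tm n) k → Vec (Tm n) l → Bool
Tms-eqᵇ [] [] = true
Tms-eqᵇ (s ∷ ss) (t ∷ ts) = Tm-eqᵇ s t ∧ᵇ Tms-eqᵇ ss ts
Tms-eqᵇ _ _ = false

Tms-eqᵇ-sound : ∀ {n k} (ss ts : Vec (Tm n) k) → T (Tms-eqᵇ ss ts) → ss ≡ ts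
Tms-eqᵇ-sound [] [] _ = refl
Tms-eqᵇ-sound (s ∷ ss) (t ∷ ts) = cong₂ᵇ _∷_ (Tm-eqᵇ-sound s t) (Tms-eqᵇ-sound ss ts)

Tms-eqᵇ-refl : ∀ {n k} (ts : Vec (Tm n) k) → T (Tms-eqᵇ ts ts)
Tms-eqᵇ-refl [] = _
Tms-eqᵇ-refl (t ∷ ts) = T-∧⁺ (Tm-eqᵇ-refl t) (Tms-eqᵇ-refl ts)

-- The arity is packed with an atom R(t⃗) so that atoms of different arities can be compared.
Atom : ℕ → Set
Atom n = Σ ℕ λ k → PR k × Vec (Tm n) k

Atom-eqᵇ : ∀ {n} → Atom n → Atom n → Bool
Atom-eqᵇ (k , f , ts) (l , g , us) = (k ≡ᵇ l) ∧ᵇ (PR-eqᵇ f g ∧ᵇ Tms-eqᵇ ts us)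

Atom-eqᵇ-sound : ∀ {n} (a b : Atom n) → T (Atom-eqᵇ a b) → a ≡ b
Atom-eqᵇ-sound (k , f , ts) (l , g , us) p with T-∧⁻ p
... | k≡l , q with ≡ᵇ⇒≡ k l k≡l
...   | refl = cong₂ᵇ (λ f ts → k , f , ts) (PR-eqᵇ-sound f g) (Tms-eqᵇ-sound ts us) q

Atom-eqᵇ-refl : ∀ {n} (a : Atom n) → T (Atom-eqᵇ a a)
Atom-eqᵇ-refl (k , f , ts) = T-∧⁺ (≡⇒≡ᵇ k k refl) (T-∧⁺ (PR-eqᵇ-refl f) (Tms-eqᵇ-refl ts))

Body-eqᵇ : ∀ {n} → Body n → Body n → Bool
Body-eqᵇ (rel k f ts) (rel l g us) = Atom-eqᵇ (k , f , ts) (l , g , us)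
Body-eqᵇ (nrel k f ts) (nrel l g us) = Atom-eqᵇ (k , f , ts) (l , g , us)
Body-eqᵇ (xb s) (xb t) = Tm-eqᵇ s t
Body-eqᵇ (nxb s) (nxb t) = Tm-eqᵇ s t
Body-eqᵇ (A ∧ B) (A′ ∧ B′) = Body-eqᵇ A A′ ∧ᵇ Body-eqᵇ B B′
Body-eqᵇ (A ∨ B) (A′ ∨ B′) = Body-eqᵇ A A′ ∧ᵇ Body-eqᵇ B B′
Body-eqᵇ (all A) (all A′) = Body-eqᵇ A A′
Body-eqᵇ (ex A) (ex A′) = Body-eqᵇ A A′
Body-eqᵇ _ _ = false

Body-eqᵇ-sound : ∀ {n} (A B : Body n) → T (Body-eqᵇ A B) → A ≡ B
Body-eqᵇ-sound (rel k f ts) (rel l g us) = cong (λ (k , f , ts) → rel k f ts) ∘ Atom-eqᵇ-sound _ _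
Body-eqᵇ-sound (nrel k f ts) (nrel l g us) = cong (λ (k , f , ts) → nrel k f ts) ∘ Atom-eqᵇ-sound _ _
Body-eqᵇ-sound (xb s) (xb t) = cong xb ∘ Tm-eqᵇ-sound s t
Body-eqᵇ-sound (nxb s) (nxb t) = cong nxb ∘ Tm-eqᵇ-sound s t
Body-eqᵇ-sound (A ∧ B) (A′ ∧ B′) = cong₂ᵇ _∧_ (Body-eqᵇ-sound A A′) (Body-eqᵇ-sound B B′)
Body-eqᵇ-sound (A ∨ B) (A′ ∨ B′) = cong₂ᵇ _∨_ (Body-eqᵇ-sound A A′) (Body-eqᵇ-sound B B′)
Body-eqᵇ-sound (all A) (all A′) = cong all ∘ Body-eqᵇ-sound A A′
Body-eqᵇ-sound (ex A) (ex A′) = cong ex ∘ Body-eqᵇ-sound A A′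

Body-eqᵇ-refl : ∀ {n} (A : Body n) → T (Body-eqᵇ A A)
Body-eqᵇ-refl (rel k f ts) = Atom-eqᵇ-refl (k , f , ts)
Body-eqᵇ-refl (nrel k f ts) = Atom-eqᵇ-refl (k , f , ts)
Body-eqᵇ-refl (xb t) = Tm-eqᵇ-refl t
Body-eqᵇ-refl (nxb t) = Tm-eqᵇ-refl t
Body-eqᵇ-refl (A ∧ B) = T-∧⁺ (Body-eqᵇ-refl A) (Body-eqᵇ-refl B)
Body-eqᵇ-refl (A ∨ B) = T-∧⁺ (Body-eqᵇ-refl A) (Body-eqᵇ-refl B)
Body-eqᵇ-refl (all A) = Body-eqᵇ-refl A
Body-eqᵇ-refl (ex A) = Body-eqᵇ-refl A

Fm-eqᵇ : ∀ {n} → Fm n → Fm n → Bool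
Fm-eqᵇ (rel k f ts) (rel l g us) = Atom-eqᵇ (k , f , ts) (l , g , us)
Fm-eqᵇ (nrel k f ts) (nrel l g us) = Atom-eqᵇ (k , f , ts) (l , g , us)
Fm-eqᵇ (sv X s) (sv Y t) = (X ≡ᵇ Y) ∧ᵇ Tm-eqᵇ s t
Fm-eqᵇ (nsv X s) (nsv Y t) = (X ≡ᵇ Y) ∧ᵇ Tm-eqᵇ s t
Fm-eqᵇ (A ∧ B) (A′ ∧ B′) = Fm-eqᵇ A A′ ∧ᵇ Fm-eqᵇ B B′
Fm-eqᵇ (A ∨ B) (A′ ∨ B′) = Fm-eqᵇ A A′ ∧ᵇ Fm-eqᵇ B B′
Fm-eqᵇ (all A) (all A′) = Fm-eqᵇ A A′
Fm-eqᵇ (ex A) (ex A′) = Fm-eqᵇ A A′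
Fm-eqᵇ (allS A) (allS A′) = Body-eqᵇ A A′
Fm-eqᵇ (exS A) (exS A′) = Body-eqᵇ A A′
Fm-eqᵇ _ _ = false

Fm-eqᵇ-sound : ∀ {n} (A B : Fm n) → T (Fm-eqᵇ A B) → A ≡ B
Fm-eqᵇ-sound (rel k f ts) (rel l g us) = cong (λ (k , f , ts) → rel k f ts) ∘ Atom-eqᵇ-sound _ _
Fm-eqᵇ-sound (nrel k f ts) (nrel l g us) = cong (λ (k , f , ts) → nrel k f ts) ∘ Atom-eqᵇ-sound _ _
Fm-eqᵇ-sound (sv X s) (sv Y t) = cong₂ᵇ sv (≡ᵇ⇒≡ X Y) (Tm-eqᵇ-sound s t)
Fm-eqᵇ-sound (nsv X s) (nsv Y t) = cong₂ᵇ nsv (≡ᵇ⇒≡ X Y) (Tm-eqᵇ-sound s t)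
Fm-eqᵇ-sound (A ∧ B) (A′ ∧ B′) = cong₂ᵇ _∧_ (Fm-eqᵇ-sound A A′) (Fm-eqᵇ-sound B B′)
Fm-eqᵇ-sound (A ∨ B) (A′ ∨ B′) = cong₂ᵇ _∨_ (Fm-eqᵇ-sound A A′) (Fm-eqᵇ-sound B B′)
Fm-eqᵇ-sound (all A) (all A′) = cong all ∘ Fm-eqᵇ-sound A A′
Fm-eqᵇ-sound (ex A) (ex A′) = cong ex ∘ Fm-eqᵇ-sound A A′
Fm-eqᵇ-sound (allS A) (allS A′) = cong allS ∘ Body-eqᵇ-sound A A′
Fm-eqᵇ-sound (exS A) (exS A′) = cong exS ∘ Body-eqᵇ-sound A A′

Fm-eqᵇ-refl : ∀ {n} (A : Fm n) → T (Fm-eqᵇ A A)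
Fm-eqᵇ-refl (rel k f ts) = Atom-eqᵇ-refl (k , f , ts)
Fm-eqᵇ-refl (nrel k f ts) = Atom-eqᵇ-refl (k , f , ts)
Fm-eqᵇ-refl (sv X t) = T-∧⁺ (≡⇒≡ᵇ X X refl) (Tm-eqᵇ-refl t)
Fm-eqᵇ-refl (nsv X t) = T-∧⁺ (≡⇒≡ᵇ X X refl) (Tm-eqᵇ-refl t)
Fm-eqᵇ-refl (A ∧ B) = T-∧⁺ (Fm-eqᵇ-refl A) (Fm-eqᵇ-refl B)
Fm-eqᵇ-refl (A ∨ B) = T-∧⁺ (Fm-eqᵇ-refl A) (Fm-eqᵇ-refl B)
Fm-eqᵇ-refl (all A) = Fm-eqᵇ-refl A
Fm-eqᵇ-refl (ex A) = Fm-eqᵇ-refl A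
Fm-eqᵇ-refl (allS A) = Body-eqᵇ-refl A
Fm-eqᵇ-refl (exS A) = Body-eqᵇ-refl A

infix 4 _≟_
_≟_ : ∀ {n} → DecidableEquality (Fm n)
A ≟ B = map′ (Fm-eqᵇ-sound A B) (λ { refl → Fm-eqᵇ-refl A }) (T? (Fm-eqᵇ A B))

negB-involutive : ∀ {n} (A : Body n) → negB (negB A) ≡ A
negB-involutive (rel k f ts) = refl
negB-involutive (nrel k f ts) = refl
negB-involutive (xb t) = refl
negB-involutive (nxb t) = refl
negB-involutive (A ∧ B) = cong₂ _∧_ (negB-involutive A) (negB-involutive B)
negB-involutive (A ∨ B) = cong₂ _∨_ (negB-involutive A) (negB-involutive B)
negB-involutive (all A) = cong all (negB-involutive A)
negB-involutive (ex A) = cong ex (negB-involutive A)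

neg-involutive : ∀ {n} (A : Fm n) → neg (neg A) ≡ A
neg-involutive (rel k f ts) = refl
neg-involutive (nrel k f ts) = refl
neg-involutive (sv X t) = refl
neg-involutive (nsv X t) = refl
neg-involutive (A ∧ B) = cong₂ _∧_ (neg-involutive A) (neg-involutive B)
neg-involutive (A ∨ B) = cong₂ _∨_ (neg-involutive A) (neg-involutive B)
neg-involutive (all A) = cong all (neg-involutive A)
neg-involutive (ex A) = cong ex (neg-involutive A)
neg-involutive (allS A) = cong allS (negB-involutive A)
neg-involutive (exS A) = cong exS (negB-involutive A)

negB-injective : ∀ {n} {A B : Body n} → negB A ≡ negB B → A ≡ B
negB-injective {A = A} {B} e = trans (sym (negB-involutive A)) (trans (cong negB e) (negB-involutive B))

neg-irreflexive : ∀ {n} (A : Fm n) → neg A ≢ A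
neg-irreflexive (rel k f ts) ()
neg-irreflexive (nrel k f ts) ()
neg-irreflexive (sv X t) ()
neg-irreflexive (nsv X t) ()
neg-irreflexive (A ∧ B) ()
neg-irreflexive (A ∨ B) ()
neg-irreflexive (all A) ()
neg-irreflexive (ex A) ()
neg-irreflexive (allS A) ()
neg-irreflexive (exS A) ()

TRUE-neg : (A : Formula) → TRUE A → ¬ TRUE (neg A)
TRUE-neg (rel k f ts) t u = t u
TRUE-neg (nrel k f ts) t u = u t

negB-substB : ∀ {n} i k (A : Body (suc n)) → negB (substB i k A) ≡ substB i k (negB A)
negB-substB i k (rel m f ts) = refl
negB-substB i k (nrel m f ts) = refl
negB-substB i k (xb t) = refl
negB-substB i k (nxb t) = refl
negB-substB i k (A ∧ B) = cong₂ _∨_ (negB-substB i k A) (negB-substB i k B)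
negB-substB i k (A ∨ B) = cong₂ _∧_ (negB-substB i k A) (negB-substB i k B)
negB-substB i k (all A) = cong ex (negB-substB _ k A)
negB-substB i k (ex A) = cong all (negB-substB _ k A)

neg-substF : ∀ {n} i k (A : Fm (suc n)) → neg (substF i k A) ≡ substF i k (neg A)
neg-substF i k (rel m f ts) = refl
neg-substF i k (nrel m f ts) = refl
neg-substF i k (sv X t) = refl
neg-substF i k (nsv X t) = refl
neg-substF i k (A ∧ B) = cong₂ _∨_ (neg-substF i k A) (neg-substF i k B)
neg-substF i k (A ∨ B) = cong₂ _∧_ (neg-substF i k A) (neg-substF i k B)
neg-substF i k (all A) = cong ex (neg-substF _ k A)
neg-substF i k (ex A) = cong all (neg-substF _ k A)
neg-substF i k (allS A) = cong exS (negB-substB i k A)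
neg-substF i k (exS A) = cong allS (negB-substB i k A)

rk-substF : ∀ {n} i k (A : Fm (suc n)) → rk (substF i k A) ≡ rk A
rk-substF i k (rel m f ts) = refl
rk-substF i k (nrel m f ts) = refl
rk-substF i k (sv X t) = refl
rk-substF i k (nsv X t) = refl
rk-substF i k (A ∧ B) = cong₂ (λ a b → suc (a ⊔ b)) (rk-substF i k A) (rk-substF i k B)
rk-substF i k (A ∨ B) = cong₂ (λ a b → suc (a ⊔ b)) (rk-substF i k A) (rk-substF i k B)
rk-substF i k (all A) = cong suc (rk-substF _ k A)
rk-substF i k (ex A) = cong suc (rk-substF _ k A)
rk-substF i k (allS A) = refl
rk-substF i k (exS A) = refl

-- Renaming set variables

renF : ∀ {n} → (ℕ → ℕ) → Fm n → Fm n
renF f (rel k g ts) = rel k g ts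
renF f (nrel k g ts) = nrel k g ts
renF f (sv X t) = sv (f X) t
renF f (nsv X t) = nsv (f X) t
renF f (A ∧ B) = renF f A ∧ renF f B
renF f (A ∨ B) = renF f A ∨ renF f B
renF f (all A) = all (renF f A)
renF f (ex A) = ex (renF f A)
renF f (allS A) = allS A
renF f (exS A) = exS A

renF-neg : ∀ {n} f (A : Fm n) → renF f (neg A) ≡ neg (renF f A)
renF-neg f (rel k g ts) = refl
renF-neg f (nrel k g ts) = refl
renF-neg f (sv X t) = refl
renF-neg f (nsv X t) = refl
renF-neg f (A ∧ B) = cong₂ _∨_ (renF-neg f A) (renF-neg f B)
renF-neg f (A ∨ B) = cong₂ _∧_ (renF-neg f A) (renF-neg f B)
renF-neg f (all A) = cong ex (renF-neg f A)
renF-neg f (ex A) = cong all (renF-neg f A)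
renF-neg f (allS A) = refl
renF-neg f (exS A) = refl

renF-substF : ∀ {n} f i k (A : Fm (suc n)) → renF f (substF i k A) ≡ substF i k (renF f A)
renF-substF f i k (rel m g ts) = refl
renF-substF f i k (nrel m g ts) = refl
renF-substF f i k (sv X t) = refl
renF-substF f i k (nsv X t) = refl
renF-substF f i k (A ∧ B) = cong₂ _∧_ (renF-substF f i k A) (renF-substF f i k B)
renF-substF f i k (A ∨ B) = cong₂ _∨_ (renF-substF f i k A) (renF-substF f i k B)
renF-substF f i k (all A) = cong all (renF-substF f _ k A)
renF-substF f i k (ex A) = cong ex (renF-substF f _ k A)
renF-substF f i k (allS A) = refl
renF-substF f i k (exS A) = refl

renF-inst : ∀ {n} f (A : Body n) Y → renF f (inst A Y) ≡ inst A (f Y)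
renF-inst f (rel k g ts) Y = refl
renF-inst f (nrel k g ts) Y = refl
renF-inst f (xb t) Y = refl
renF-inst f (nxb t) Y = refl
renF-inst f (A ∧ B) Y = cong₂ _∧_ (renF-inst f A Y) (renF-inst f B Y)
renF-inst f (A ∨ B) Y = cong₂ _∨_ (renF-inst f A Y) (renF-inst f B Y)
renF-inst f (all A) Y = cong all (renF-inst f A Y)
renF-inst f (ex A) Y = cong ex (renF-inst f A Y)

rk-renF : ∀ {n} f (A : Fm n) → rk (renF f A) ≡ rk A
rk-renF f (rel k g ts) = refl
rk-renF f (nrel k g ts) = refl
rk-renF f (sv X t) = refl
rk-renF f (nsv X t) = refl
rk-renF f (A ∧ B) = cong₂ (λ a b → suc (a ⊔ b)) (rk-renF f A) (rk-renF f B)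
rk-renF f (A ∨ B) = cong₂ (λ a b → suc (a ⊔ b)) (rk-renF f A) (rk-renF f B)
rk-renF f (all A) = cong suc (rk-renF f A)
rk-renF f (ex A) = cong suc (rk-renF f A)
rk-renF f (allS A) = refl
rk-renF f (exS A) = refl

TRUE-renF : ∀ f (A : Formula) → TRUE A → TRUE (renF f A)
TRUE-renF f (rel k g ts) t = t
TRUE-renF f (nrel k g ts) t = t

Pi1-renF : ∀ {n} f (A : Fm n) → Pi1 A → Pi1 (renF f A)
Pi1-renF f (rel k g ts) p = p
Pi1-renF f (nrel k g ts) p = p
Pi1-renF f (sv X t) p = p
Pi1-renF f (nsv X t) p = p
Pi1-renF f (A ∧ B) (p , q) = Pi1-renF f A p , Pi1-renF f B q
Pi1-renF f (A ∨ B) (p , q) = Pi1-renF f A p , Pi1-renF f B q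
Pi1-renF f (all A) p = Pi1-renF f A p
Pi1-renF f (ex A) p = Pi1-renF f A p
Pi1-renF f (allS A) p = p

renF-∘ : ∀ {n} f g (A : Fm n) → renF f (renF g A) ≡ renF (f ∘ g) A
renF-∘ f g (rel k h ts) = refl
renF-∘ f g (nrel k h ts) = refl
renF-∘ f g (sv X t) = refl
renF-∘ f g (nsv X t) = refl
renF-∘ f g (A ∧ B) = cong₂ _∧_ (renF-∘ f g A) (renF-∘ f g B)
renF-∘ f g (A ∨ B) = cong₂ _∨_ (renF-∘ f g A) (renF-∘ f g B)
renF-∘ f g (all A) = cong all (renF-∘ f g A)
renF-∘ f g (ex A) = cong ex (renF-∘ f g A)
renF-∘ f g (allS A) = refl
renF-∘ f g (exS A) = refl

renF-fixes : ∀ {n} f (A : Fm n) → (∀ Y → Occ Y A → f Y ≡ Y) → renF f A ≡ A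
renF-fixes f (rel k h ts) e = refl
renF-fixes f (nrel k h ts) e = refl
renF-fixes f (sv X t) e = cong (λ Y → sv Y t) (e X refl)
renF-fixes f (nsv X t) e = cong (λ Y → nsv Y t) (e X refl)
renF-fixes f (A ∧ B) e =
  cong₂ _∧_ (renF-fixes f A (λ Y → e Y ∘ inj₁)) (renF-fixes f B (λ Y → e Y ∘ inj₂))
renF-fixes f (A ∨ B) e =
  cong₂ _∨_ (renF-fixes f A (λ Y → e Y ∘ inj₁)) (renF-fixes f B (λ Y → e Y ∘ inj₂))
renF-fixes f (all A) e = cong all (renF-fixes f A e)
renF-fixes f (ex A) e = cong ex (renF-fixes f A e)
renF-fixes f (allS A) e = refl
renF-fixes f (exS A) e = refl

Occ-renF⁻ : ∀ {n} {f} → Injective _≡_ _≡_ f → ∀ Y (A : Fm n) → Occ (f Y) (renF f A) → Occ Y A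
Occ-renF⁻ f-inj Y (sv X t) o = f-inj o
Occ-renF⁻ f-inj Y (nsv X t) o = f-inj o
Occ-renF⁻ f-inj Y (A ∧ B) (inj₁ o) = inj₁ (Occ-renF⁻ f-inj Y A o)
Occ-renF⁻ f-inj Y (A ∧ B) (inj₂ o) = inj₂ (Occ-renF⁻ f-inj Y B o)
Occ-renF⁻ f-inj Y (A ∨ B) (inj₁ o) = inj₁ (Occ-renF⁻ f-inj Y A o)
Occ-renF⁻ f-inj Y (A ∨ B) (inj₂ o) = inj₂ (Occ-renF⁻ f-inj Y B o)
Occ-renF⁻ f-inj Y (all A) o = Occ-renF⁻ f-inj Y A o
Occ-renF⁻ f-inj Y (ex A) o = Occ-renF⁻ f-inj Y A o

swap : ℕ → ℕ → ℕ → ℕ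
swap a b x with x ≟ℕ a | x ≟ℕ b
... | yes _ | _     = b
... | no _  | yes _ = a
... | no _  | no _  = x

swap-fixes : ∀ a b {x} → x ≢ a → x ≢ b → swap a b x ≡ x
swap-fixes a b {x} x≢a x≢b with x ≟ℕ a | x ≟ℕ b
... | yes x≡a | _       = contradiction x≡a x≢a
... | no _    | yes x≡b = contradiction x≡b x≢b
... | no _    | no _    = refl

swap-left : ∀ a b → swap a b a ≡ b
swap-left a b with a ≟ℕ a
... | yes _   = refl
... | no a≢a = contradiction refl a≢a

swap-right : ∀ a b → swap a b b ≡ a
swap-right a b with b ≟ℕ a | b ≟ℕ b
... | yes b≡a | _       = b≡a
... | no _    | yes _   = refl
... | no _    | no b≢b = contradiction refl b≢b

swap-involutive : ∀ a b x → swap a b (swap a b x) ≡ x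
swap-involutive a b x with x ≟ℕ a | x ≟ℕ b
... | yes refl | _        = swap-right a b
... | no _     | yes refl = swap-left a b
... | no x≢a   | no x≢b   = swap-fixes a b x≢a x≢b

swap-injective : ∀ a b → Injective _≡_ _≡_ (swap a b)
swap-injective a b {x} {y} e =
  trans (sym (swap-involutive a b x)) (trans (cong (swap a b) e) (swap-involutive a b y))

swapF : ∀ {n} → ℕ → ℕ → Fm n → Fm n
swapF a b = renF (swap a b)

swapF-involutive : ∀ {n} a b (A : Fm n) → swapF a b (swapF a b A) ≡ A
swapF-involutive a b A = trans (renF-∘ _ _ A) (renF-fixes _ A (λ Y _ → swap-involutive a b Y))

swapF-fresh : ∀ {n} a b (A : Fm n) → ¬ Occ a A → ¬ Occ b A → swapF a b A ≡ A
swapF-fresh a b A a∉A b∉A =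
  renF-fixes _ A (λ Y o → swap-fixes a b (λ { refl → a∉A o }) (λ { refl → b∉A o }))

maxVar : ∀ {n} → Fm n → ℕ
maxVar (rel k g ts) = 0
maxVar (nrel k g ts) = 0
maxVar (sv X t) = X
maxVar (nsv X t) = X
maxVar (A ∧ B) = maxVar A ⊔ maxVar B
maxVar (A ∨ B) = maxVar A ⊔ maxVar B
maxVar (all A) = maxVar A
maxVar (ex A) = maxVar A
maxVar (allS A) = 0
maxVar (exS A) = 0

Occ⇒≤maxVar : ∀ {n} Y (A : Fm n) → Occ Y A → Y ≤ maxVar A
Occ⇒≤maxVar Y (sv X t) refl = ≤-refl
Occ⇒≤maxVar Y (nsv X t) refl = ≤-refl
Occ⇒≤maxVar Y (A ∧ B) (inj₁ o) = m≤n⇒m≤n⊔o _ (Occ⇒≤maxVar Y A o)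
Occ⇒≤maxVar Y (A ∧ B) (inj₂ o) = m≤n⇒m≤o⊔n _ (Occ⇒≤maxVar Y B o)
Occ⇒≤maxVar Y (A ∨ B) (inj₁ o) = m≤n⇒m≤n⊔o _ (Occ⇒≤maxVar Y A o)
Occ⇒≤maxVar Y (A ∨ B) (inj₂ o) = m≤n⇒m≤o⊔n _ (Occ⇒≤maxVar Y B o)
Occ⇒≤maxVar Y (all A) o = Occ⇒≤maxVar Y A o
Occ⇒≤maxVar Y (ex A) o = Occ⇒≤maxVar Y A o

maxVarSeq : Seq → ℕ
maxVarSeq [] = 0
maxVarSeq (A ∷ Γ) = maxVar A ⊔ maxVarSeq Γ

maxVar≤maxVarSeq : ∀ {A} Γ → A ∈ Γ → maxVar A ≤ maxVarSeq Γ
maxVar≤maxVarSeq (B ∷ Γ) (here refl) = m≤m⊔n _ _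
maxVar≤maxVarSeq (B ∷ Γ) (there A∈Γ) = m≤n⇒m≤o⊔n _ (maxVar≤maxVarSeq Γ A∈Γ)

fresh : Seq → ℕ
fresh Γ = suc (maxVarSeq Γ)

fresh-notFree : ∀ Γ → NotFree (fresh Γ) Γ
fresh-notFree Γ {A} A∈Γ o = 1+n≰n (≤-trans (Occ⇒≤maxVar _ A o) (maxVar≤maxVarSeq Γ A∈Γ))

fresh-notFreeˡ : ∀ Γ Δ → NotFree (fresh (Γ ++ Δ)) Γ
fresh-notFreeˡ Γ Δ = fresh-notFree (Γ ++ Δ) ∘ ∈-++⁺ˡ

fresh-notFreeʳ : ∀ Γ Δ → NotFree (fresh (Γ ++ Δ)) Δ
fresh-notFreeʳ Γ Δ = fresh-notFree (Γ ++ Δ) ∘ ∈-++⁺ʳ Γ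

module _ (a b : ℕ) where

  swapSeq : Seq → Seq
  swapSeq = map (swapF a b)

  private
    S : Formula → Formula
    S = swapF a b

    ∈-swap : ∀ {A Γ} → A ∈ Γ → S A ∈ swapSeq Γ
    ∈-swap = ∈-map⁺ S

    ∈-swap≡ : ∀ {A B Γ} → A ∈ Γ → S A ≡ B → B ∈ swapSeq Γ
    ∈-swap≡ A∈Γ refl = ∈-swap A∈Γ

    ⊆-swap : ∀ {Δ Γ} → Δ ⊆ Γ → swapSeq Δ ⊆ swapSeq Γ
    ⊆-swap Δ⊆Γ B∈ with ∈-map⁻ S B∈
    ... | A , A∈Δ , refl = ∈-swap (Δ⊆Γ A∈Δ)

    ⊆∷-swap : ∀ {Δ Γ A B} → Δ ⊆ A ∷ Γ → S A ≡ B → swapSeq Δ ⊆ B ∷ swapSeq Γ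
    ⊆∷-swap Δ⊆ SA≡B = subst (λ C → _ ⊆ C ∷ _) SA≡B (⊆-swap Δ⊆)

    notFree-swap : ∀ {Y Γ} → NotFree Y Γ → NotFree (swap a b Y) (swapSeq Γ)
    notFree-swap {Y} Y∉Γ B∈ o with ∈-map⁻ S B∈
    ... | A , A∈Γ , refl = Y∉Γ A∈Γ (Occ-renF⁻ (swap-injective a b) Y A o)

    swap-neg : ∀ C → S (neg C) ≡ neg (S C)
    swap-neg = renF-neg (swap a b)

    swap-inst : ∀ (A : Body 0) Y → S (inst A Y) ≡ inst A (swap a b Y)
    swap-inst = renF-inst (swap a b)

    swap-[] : ∀ (A : Fm 1) k → S (A [ k ]) ≡ swapF a b A [ k ]
    swap-[] A k = renF-substF (swap a b) _ k A

  swapDer₀ : ∀ {Γ} → Der0 Γ → Der0 (swapSeq Γ)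
  swapDer₀ (ax A t m) = ax (S A) (TRUE-renF _ A t) (∈-swap m)
  swapDer₀ (axC C m m′) = axC (S C) (∈-swap m) (∈-swap≡ m′ (swap-neg C))
  swapDer₀ (andI A B m Δ₀ d s Δ₁ d₁ s₁) =
    andI (S A) (S B) (∈-swap m) _ (swapDer₀ d) (⊆∷-swap s refl) _ (swapDer₀ d₁) (⊆∷-swap s₁ refl)
  swapDer₀ (orI₀ A B m Δ d s) = orI₀ (S A) (S B) (∈-swap m) _ (swapDer₀ d) (⊆∷-swap s refl)
  swapDer₀ (orI₁ A B m Δ d s) = orI₁ (S A) (S B) (∈-swap m) _ (swapDer₀ d) (⊆∷-swap s refl)
  swapDer₀ (allI A m Δ ds s) =
    allI (swapF a b A) (∈-swap m) _ (λ n → swapDer₀ (ds n)) (λ n → ⊆∷-swap (s n) (swap-[] A n))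
  swapDer₀ (exI A m k Δ d s) = exI (swapF a b A) (∈-swap m) k _ (swapDer₀ d) (⊆∷-swap s (swap-[] A k))
  swapDer₀ (allSI A m Y Y∉Γ Δ d s) =
    allSI A (∈-swap m) (swap a b Y) (notFree-swap Y∉Γ) _ (swapDer₀ d) (⊆∷-swap s (swap-inst A Y))
  swapDer₀ (cut C Δ₀ d s Δ₁ d₁ s₁) =
    cut (S C) _ (swapDer₀ d) (⊆∷-swap s refl) _ (swapDer₀ d₁) (⊆∷-swap s₁ (swap-neg C))
  swapDer₀ (rep Δ d s) = rep _ (swapDer₀ d) (⊆-swap s)

  swapDer₀-cutFree : ∀ {Γ} (d : Der0 Γ) → CutFree d → CutFree (swapDer₀ d)
  swapDer₀-cutFree (ax A t m) _ = _
  swapDer₀-cutFree (axC C m m′) _ = _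
  swapDer₀-cutFree (andI A B m Δ₀ d s Δ₁ d₁ s₁) (c , c₁) =
    swapDer₀-cutFree d c , swapDer₀-cutFree d₁ c₁
  swapDer₀-cutFree (orI₀ A B m Δ d s) c = swapDer₀-cutFree d c
  swapDer₀-cutFree (orI₁ A B m Δ d s) c = swapDer₀-cutFree d c
  swapDer₀-cutFree (allI A m Δ ds s) c = λ n → swapDer₀-cutFree (ds n) (c n)
  swapDer₀-cutFree (exI A m k Δ d s) c = swapDer₀-cutFree d c
  swapDer₀-cutFree (allSI A m Y Y∉Γ Δ d s) c = swapDer₀-cutFree d c
  swapDer₀-cutFree (rep Δ d s) c = swapDer₀-cutFree d c

  swapIdx : ∀ {A} → Idx A → Idx A
  swapIdx {A} (idx Γ e e-cf Γ-Pi1 Z Z-fresh) =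
    idx (swapSeq Γ) (swapDer₀ e) (swapDer₀-cutFree e e-cf) Pi1-swap (swap a b Z) fresh-swap
    where
    Pi1-swap : Pi1Seq (swapSeq Γ)
    Pi1-swap B∈ with ∈-map⁻ S B∈
    ... | B , B∈Γ , refl = Pi1-renF _ B (Γ-Pi1 B∈Γ)
    fresh-swap : ∀ {B} → B ∈ swapSeq Γ → B ≢ inst A (swap a b Z) → ¬ Occ (swap a b Z) B
    fresh-swap B∈ B≢ o with ∈-map⁻ S B∈
    ... | B , B∈Γ , refl =
      Z-fresh B∈Γ (λ { refl → B≢ (swap-inst A Z) }) (Occ-renF⁻ (swap-injective a b) Z B o)

  private
    SubΔq-swap : ∀ {A Γ} (q : Idx A) {Δ} →
                 SubΔq A (swapIdx q) Δ Γ → SubΔq A q (swapSeq Δ) (swapSeq Γ)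
    SubΔq-swap {A} (idx Γq e e-cf Γ-Pi1 Z Z-fresh) Δ⊆ B∈ with ∈-map⁻ S B∈
    ... | B , B∈Δ , refl with Δ⊆ B∈Δ
    ...   | inj₁ B∈Γ = inj₁ (∈-swap B∈Γ)
    ...   | inj₂ (SB′∈ , B≢) with ∈-map⁻ S SB′∈
    ...     | B′ , B′∈Γq , refl =
      inj₂ ( subst (_∈ Γq) (sym (swapF-involutive a b B′)) B′∈Γq
           , λ e → B≢ (trans (sym (swapF-involutive a b (S B′))) (trans (cong S e) (swap-inst A Z))))

  swapDer : ∀ {Γ} → Der Γ → Der (swapSeq Γ)
  swapDer (ax A t m) = ax (S A) (TRUE-renF _ A t) (∈-swap m)
  swapDer (axC C m m′) = axC (S C) (∈-swap m) (∈-swap≡ m′ (swap-neg C))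
  swapDer (andI A B m Δ₀ d s Δ₁ d₁ s₁) =
    andI (S A) (S B) (∈-swap m) _ (swapDer d) (⊆∷-swap s refl) _ (swapDer d₁) (⊆∷-swap s₁ refl)
  swapDer (orI₀ A B m Δ d s) = orI₀ (S A) (S B) (∈-swap m) _ (swapDer d) (⊆∷-swap s refl)
  swapDer (orI₁ A B m Δ d s) = orI₁ (S A) (S B) (∈-swap m) _ (swapDer d) (⊆∷-swap s refl)
  swapDer (allI A m Δ ds s) =
    allI (swapF a b A) (∈-swap m) _ (λ n → swapDer (ds n)) (λ n → ⊆∷-swap (s n) (swap-[] A n))
  swapDer (exI A m k Δ d s) = exI (swapF a b A) (∈-swap m) k _ (swapDer d) (⊆∷-swap s (swap-[] A k))
  swapDer (allSI A m Y Y∉Γ Δ d s) =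
    allSI A (∈-swap m) (swap a b Y) (notFree-swap Y∉Γ) _ (swapDer d) (⊆∷-swap s (swap-inst A Y))
  swapDer (cut C Δ₀ d s Δ₁ d₁ s₁) =
    cut (S C) _ (swapDer d) (⊆∷-swap s refl) _ (swapDer d₁) (⊆∷-swap s₁ (swap-neg C))
  swapDer (rep Δ d s) = rep _ (swapDer d) (⊆-swap s)
  -- Premise q of the renamed Ω-inference is the renamed premise swapIdx q (swapIdx is an involution).
  swapDer (omega A m Δ ds s) =
    omega A (∈-swap m) _ (λ q → swapDer (ds (swapIdx q))) (λ q → SubΔq-swap q (s (swapIdx q)))
  swapDer (omegaT A Y Y∉Γ Δ₀ d s Δ ds s′) =
    omegaT A (swap a b Y) (notFree-swap Y∉Γ) _ (swapDer d) (⊆∷-swap s (swap-inst A Y))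
           _ (λ q → swapDer (ds (swapIdx q))) (λ q → SubΔq-swap q (s′ (swapIdx q)))

  swapDer-dg : ∀ m {Γ} (d : Der Γ) → DgLe m d → DgLe m (swapDer d)
  swapDer-dg m (ax _ _ _) _ = _
  swapDer-dg m (axC _ _ _) _ = _
  swapDer-dg m (andI _ _ _ _ d _ _ d₁ _) (g , g₁) = swapDer-dg m d g , swapDer-dg m d₁ g₁
  swapDer-dg m (orI₀ _ _ _ _ d _) g = swapDer-dg m d g
  swapDer-dg m (orI₁ _ _ _ _ d _) g = swapDer-dg m d g
  swapDer-dg m (allI _ _ _ ds _) g = λ n → swapDer-dg m (ds n) (g n)
  swapDer-dg m (exI _ _ _ _ d _) g = swapDer-dg m d g
  swapDer-dg m (allSI _ _ _ _ _ d _) g = swapDer-dg m d g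
  swapDer-dg m (cut C _ d _ _ d₁ _) (r , g , g₁) =
    subst (λ k → suc k ≤ m) (sym (rk-renF _ C)) r , swapDer-dg m d g , swapDer-dg m d₁ g₁
  swapDer-dg m (rep _ d _) g = swapDer-dg m d g
  swapDer-dg m (omega _ _ _ ds _) g = λ q → swapDer-dg m (ds (swapIdx q)) (g (swapIdx q))
  swapDer-dg m (omegaT _ _ _ _ d _ _ ds _) (g , gs) =
    swapDer-dg m d g , λ q → swapDer-dg m (ds (swapIdx q)) (gs (swapIdx q))

  swapDeriv : Deriv → Deriv
  swapDeriv (Γ , d) = swapSeq Γ , swapDer d

⊆-swapEigen : ∀ {Y Z Δ Δ′} (B : Body 0) → NotFree Y Δ → NotFree Z Δ →
              Δ′ ⊆ inst B Y ∷ Δ → swapSeq Y Z Δ′ ⊆ inst B Z ∷ Δ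
⊆-swapEigen {Y} {Z} {Δ} B Y∉Δ Z∉Δ Δ′⊆ A∈ with ∈-map⁻ (swapF Y Z) A∈
... | A , A∈Δ′ , refl with Δ′⊆ A∈Δ′
...   | here refl = here (trans (renF-inst _ B Y) (cong (inst B) (swap-left Y Z)))
...   | there A∈Δ = there (subst (_∈ Δ) (sym (swapF-fresh Y Z A (Y∉Δ A∈Δ) (Z∉Δ A∈Δ))) A∈Δ)

-- Premises up to renaming

infix 4 _◁_ _≺_ _⊏_

data _◁_ : Deriv → Deriv → Set where
  ◁-andI₀   : ∀ {Γ A B m Δ₀ d} {s : Δ₀ ⊆ A ∷ Γ} {Δ₁ d₁} {s₁ : Δ₁ ⊆ B ∷ Γ} →
              (Δ₀ , d) ◁ (Γ , andI A B m Δ₀ d s Δ₁ d₁ s₁)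
  ◁-andI₁   : ∀ {Γ A B m Δ₀ d} {s : Δ₀ ⊆ A ∷ Γ} {Δ₁ d₁} {s₁ : Δ₁ ⊆ B ∷ Γ} →
              (Δ₁ , d₁) ◁ (Γ , andI A B m Δ₀ d s Δ₁ d₁ s₁)
  ◁-orI₀    : ∀ {Γ A B m Δ d} {s : Δ ⊆ A ∷ Γ} → (Δ , d) ◁ (Γ , orI₀ A B m Δ d s)
  ◁-orI₁    : ∀ {Γ A B m Δ d} {s : Δ ⊆ B ∷ Γ} → (Δ , d) ◁ (Γ , orI₁ A B m Δ d s)
  ◁-allI    : ∀ {Γ A m Δ ds} {s : ∀ n → Δ n ⊆ A [ n ] ∷ Γ} n → (Δ n , ds n) ◁ (Γ , allI A m Δ ds s)
  ◁-exI     : ∀ {Γ A m k Δ d} {s : Δ ⊆ A [ k ] ∷ Γ} → (Δ , d) ◁ (Γ , exI A m k Δ d s)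
  ◁-allSI   : ∀ {Γ A m Y} {Y∉Γ : NotFree Y Γ} {Δ d} {s : Δ ⊆ inst A Y ∷ Γ} →
              (Δ , d) ◁ (Γ , allSI A m Y Y∉Γ Δ d s)
  ◁-cut₀    : ∀ {Γ C Δ₀ d} {s : Δ₀ ⊆ C ∷ Γ} {Δ₁ d₁} {s₁ : Δ₁ ⊆ neg C ∷ Γ} →
              (Δ₀ , d) ◁ (Γ , cut C Δ₀ d s Δ₁ d₁ s₁)
  ◁-cut₁    : ∀ {Γ C Δ₀ d} {s : Δ₀ ⊆ C ∷ Γ} {Δ₁ d₁} {s₁ : Δ₁ ⊆ neg C ∷ Γ} →
              (Δ₁ , d₁) ◁ (Γ , cut C Δ₀ d s Δ₁ d₁ s₁)
  ◁-rep     : ∀ {Γ Δ d} {s : Δ ⊆ Γ} → (Δ , d) ◁ (Γ , rep Δ d s)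
  ◁-omega   : ∀ {Γ A m Δ ds} {s : ∀ q → SubΔq A q (Δ q) Γ} q → (Δ q , ds q) ◁ (Γ , omega A m Δ ds s)
  ◁-omegaT₀ : ∀ {Γ A Y} {Y∉Γ : NotFree Y Γ} {Δ₀ d} {s : Δ₀ ⊆ inst A Y ∷ Γ}
                {Δ ds} {s′ : ∀ q → SubΔq A q (Δ q) Γ} →
              (Δ₀ , d) ◁ (Γ , omegaT A Y Y∉Γ Δ₀ d s Δ ds s′)
  ◁-omegaT  : ∀ {Γ A Y} {Y∉Γ : NotFree Y Γ} {Δ₀ d} {s : Δ₀ ⊆ inst A Y ∷ Γ}
                {Δ ds} {s′ : ∀ q → SubΔq A q (Δ q) Γ} q →
              (Δ q , ds q) ◁ (Γ , omegaT A Y Y∉Γ Δ₀ d s Δ ds s′)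

◁-swapDeriv : ∀ a b {Γ} (d : Der Γ) {p} → p ◁ swapDeriv a b (Γ , d) →
              Σ Deriv λ p′ → p′ ◁ (Γ , d) × p ≡ swapDeriv a b p′
◁-swapDeriv a b (andI A B m Δ₀ d s Δ₁ d₁ s₁) ◁-andI₀ = _ , ◁-andI₀ , refl
◁-swapDeriv a b (andI A B m Δ₀ d s Δ₁ d₁ s₁) ◁-andI₁ = _ , ◁-andI₁ , refl
◁-swapDeriv a b (orI₀ A B m Δ d s) ◁-orI₀ = _ , ◁-orI₀ , refl
◁-swapDeriv a b (orI₁ A B m Δ d s) ◁-orI₁ = _ , ◁-orI₁ , refl
◁-swapDeriv a b (allI A m Δ ds s) (◁-allI n) = _ , ◁-allI n , refl
◁-swapDeriv a b (exI A m k Δ d s) ◁-exI = _ , ◁-exI , refl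
◁-swapDeriv a b (allSI A m Y Y∉Γ Δ d s) ◁-allSI = _ , ◁-allSI , refl
◁-swapDeriv a b (cut C Δ₀ d s Δ₁ d₁ s₁) ◁-cut₀ = _ , ◁-cut₀ , refl
◁-swapDeriv a b (cut C Δ₀ d s Δ₁ d₁ s₁) ◁-cut₁ = _ , ◁-cut₁ , refl
◁-swapDeriv a b (rep Δ d s) ◁-rep = _ , ◁-rep , refl
◁-swapDeriv a b (omega A m Δ ds s) (◁-omega q) = _ , ◁-omega (swapIdx a b q) , refl
◁-swapDeriv a b (omegaT A Y Y∉Γ Δ₀ d s Δ ds s′) ◁-omegaT₀ = _ , ◁-omegaT₀ , refl
◁-swapDeriv a b (omegaT A Y Y∉Γ Δ₀ d s Δ ds s′) (◁-omegaT q) = _ , ◁-omegaT (swapIdx a b q) , refl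

swapAll : List (ℕ × ℕ) → Deriv → Deriv
swapAll σ p = foldr (λ (a , b) → swapDeriv a b) p σ

_≺_ : Deriv → Deriv → Set
p ≺ d = Σ (List (ℕ × ℕ)) λ σ → Σ Deriv λ p′ → p′ ◁ d × p ≡ swapAll σ p′

Acc-swapDeriv : ∀ a b d → Acc _≺_ d → Acc _≺_ (swapDeriv a b d)
Acc-swapDeriv a b (Γ , d) (acc rs) =
  acc λ { (σ , p , p◁ , refl) → renamed-premise σ (◁-swapDeriv a b d p◁) }
  where
  renamed-premise : ∀ σ {p} → Σ Deriv (λ p′ → p′ ◁ (Γ , d) × p ≡ swapDeriv a b p′) →
                    Acc _≺_ (swapAll σ p)
  renamed-premise σ (p′ , p′◁ , refl) =
    rs (σ ++ (a , b) ∷ [] , p′ , p′◁ , sym (foldr-++ (λ (a , b) → swapDeriv a b) p′ σ _))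

Acc-swapAll : ∀ σ d → Acc _≺_ d → Acc _≺_ (swapAll σ d)
Acc-swapAll [] d d-acc = d-acc
Acc-swapAll ((a , b) ∷ σ) d d-acc = Acc-swapDeriv a b _ (Acc-swapAll σ d d-acc)

mutual
  Der-acc : ∀ Γ (d : Der Γ) → Acc _≺_ (Γ , d)
  Der-acc Γ d = acc λ { (σ , p , p◁ , refl) → Acc-swapAll σ p (◁-acc Γ d p◁) }

  ◁-acc : ∀ Γ (d : Der Γ) {p} → p ◁ (Γ , d) → Acc _≺_ p
  ◁-acc Γ (andI A B m Δ₀ d s Δ₁ d₁ s₁) ◁-andI₀ = Der-acc _ d
  ◁-acc Γ (andI A B m Δ₀ d s Δ₁ d₁ s₁) ◁-andI₁ = Der-acc _ d₁
  ◁-acc Γ (orI₀ A B m Δ d s) ◁-orI₀ = Der-acc _ d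
  ◁-acc Γ (orI₁ A B m Δ d s) ◁-orI₁ = Der-acc _ d
  ◁-acc Γ (allI A m Δ ds s) (◁-allI n) = Der-acc _ (ds n)
  ◁-acc Γ (exI A m k Δ d s) ◁-exI = Der-acc _ d
  ◁-acc Γ (allSI A m Y Y∉Γ Δ d s) ◁-allSI = Der-acc _ d
  ◁-acc Γ (cut C Δ₀ d s Δ₁ d₁ s₁) ◁-cut₀ = Der-acc _ d
  ◁-acc Γ (cut C Δ₀ d s Δ₁ d₁ s₁) ◁-cut₁ = Der-acc _ d₁
  ◁-acc Γ (rep Δ d s) ◁-rep = Der-acc _ d
  ◁-acc Γ (omega A m Δ ds s) (◁-omega q) = Der-acc _ (ds q)
  ◁-acc Γ (omegaT A Y Y∉Γ Δ₀ d s Δ ds s′) ◁-omegaT₀ = Der-acc _ d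
  ◁-acc Γ (omegaT A Y Y∉Γ Δ₀ d s Δ ds s′) (◁-omegaT q) = Der-acc _ (ds q)

≺-wellFounded : WellFounded _≺_
≺-wellFounded (Γ , d) = Der-acc Γ d

_⊏_ : Deriv × Deriv → Deriv × Deriv → Set
_⊏_ = ×-Lex _≡_ _≺_ _≺_

⊏-wellFounded : WellFounded _⊏_
⊏-wellFounded = ×-wellFounded ≺-wellFounded ≺-wellFounded

◁⇒≺ : ∀ {p d} → p ◁ d → p ≺ d
◁⇒≺ p◁ = [] , _ , p◁ , refl

swap-◁⇒≺ : ∀ a b {p d} → p ◁ d → swapDeriv a b p ≺ d
swap-◁⇒≺ a b p◁ = (a , b) ∷ [] , _ , p◁ , refl

◁-dg : ∀ {m p d} → p ◁ d → DgLe m (proj₂ d) → DgLe m (proj₂ p)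
◁-dg ◁-andI₀ (g , _) = g
◁-dg ◁-andI₁ (_ , g) = g
◁-dg ◁-orI₀ g = g
◁-dg ◁-orI₁ g = g
◁-dg (◁-allI n) g = g n
◁-dg ◁-exI g = g
◁-dg ◁-allSI g = g
◁-dg ◁-cut₀ (_ , g , _) = g
◁-dg ◁-cut₁ (_ , _ , g) = g
◁-dg ◁-rep g = g
◁-dg (◁-omega q) g = g q
◁-dg ◁-omegaT₀ (g , _) = g
◁-dg (◁-omegaT q) (_ , g) = g q

open import Data.List.Membership.DecPropositional {A = Formula} _≟_ using (_∈?_)

_∖_ : Seq → Formula → Seq
Γ ∖ C = filter (λ A → ¬? (A ≟ C)) Γ

∈-∖⁺ : ∀ {A C} Γ → A ∈ Γ → A ≢ C → A ∈ Γ ∖ C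
∈-∖⁺ {C = C} Γ = ∈-filter⁺ (λ A → ¬? (A ≟ C))

∈-∖⁻ : ∀ {A C} Γ → A ∈ Γ ∖ C → A ∈ Γ × A ≢ C
∈-∖⁻ {C = C} Γ = ∈-filter⁻ (λ A → ¬? (A ≟ C))

opaque
  cutSeq : Formula → Seq → Seq → Seq
  cutSeq C Δ₀ Δ₁ = Δ₀ ∖ C ++ Δ₁ ∖ neg C

  ∈-cutSeq⁺ˡ : ∀ {C Δ₀ Δ₁ A} → A ∈ Δ₀ → A ≢ C → A ∈ cutSeq C Δ₀ Δ₁
  ∈-cutSeq⁺ˡ {Δ₀ = Δ₀} A∈ A≢C = ∈-++⁺ˡ (∈-∖⁺ Δ₀ A∈ A≢C)

  ∈-cutSeq⁺ʳ : ∀ {C Δ₀ Δ₁ A} → A ∈ Δ₁ → A ≢ neg C → A ∈ cutSeq C Δ₀ Δ₁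
  ∈-cutSeq⁺ʳ {C} {Δ₀} {Δ₁} A∈ A≢¬C = ∈-++⁺ʳ (Δ₀ ∖ C) (∈-∖⁺ Δ₁ A∈ A≢¬C)

  ∈-cutSeq⁻ : ∀ {C Δ₀ Δ₁ A} → A ∈ cutSeq C Δ₀ Δ₁ →
              (A ∈ Δ₀ × A ≢ C) ⊎ (A ∈ Δ₁ × A ≢ neg C)
  ∈-cutSeq⁻ {C} {Δ₀} {Δ₁} A∈ with ∈-++⁻ (Δ₀ ∖ C) A∈
  ... | inj₁ A∈₀ = inj₁ (∈-∖⁻ Δ₀ A∈₀)
  ... | inj₂ A∈₁ = inj₂ (∈-∖⁻ Δ₁ A∈₁)

-- Monotonicity relative to an arbitrary extra predicate P; P is instantiated by (_≡ A) for minor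
-- formulas and by InΔq for the premises of Ω-rules.
Monotone : (Seq → Seq) → Set₁
Monotone F = ∀ {Δ Δ′} {P : Formula → Set} → (∀ {A} → A ∈ Δ′ → A ∈ Δ ⊎ P A) →
             ∀ {A} → A ∈ F Δ′ → A ∈ F Δ ⊎ P A

module _ {F : Seq → Seq} (F-mono : Monotone F) where

  Monotone⇒⊆∷ : ∀ {Δ Δ′ A} → Δ′ ⊆ A ∷ Δ → F Δ′ ⊆ A ∷ F Δ
  Monotone⇒⊆∷ Δ′⊆ = [ there , here ]′ ∘ F-mono (⊎-swap ∘ toSum ∘ Δ′⊆)

  Monotone⇒⊆ : ∀ {Δ Δ′} → Δ′ ⊆ Δ → F Δ′ ⊆ F Δ
  Monotone⇒⊆ Δ′⊆ A∈ with F-mono {P = λ _ → ⊥} (inj₁ ∘ Δ′⊆) A∈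
  ... | inj₁ A∈F = A∈F

cutSeq-monoˡ : ∀ {C Δ₁} → Monotone (λ Δ → cutSeq C Δ Δ₁)
cutSeq-monoˡ Δ′⊆ A∈ with ∈-cutSeq⁻ A∈
... | inj₂ (A∈₁ , A≢¬C) = inj₁ (∈-cutSeq⁺ʳ A∈₁ A≢¬C)
... | inj₁ (A∈′ , A≢C) with Δ′⊆ A∈′
...   | inj₁ A∈ = inj₁ (∈-cutSeq⁺ˡ A∈ A≢C)
...   | inj₂ PA = inj₂ PA

cutSeq-monoʳ : ∀ {C Δ₀} → Monotone (cutSeq C Δ₀)
cutSeq-monoʳ Δ′⊆ A∈ with ∈-cutSeq⁻ A∈
... | inj₁ (A∈₀ , A≢C) = inj₁ (∈-cutSeq⁺ˡ A∈₀ A≢C)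
... | inj₂ (A∈′ , A≢¬C) with Δ′⊆ A∈′
...   | inj₁ A∈ = inj₁ (∈-cutSeq⁺ʳ A∈ A≢¬C)
...   | inj₂ PA = inj₂ PA

∈-cutSeq⁺ : ∀ {C Δ₀ Δ₁ A} → A ∈ Δ₀ → (A ≡ C → A ∈ Δ₁) → A ∈ cutSeq C Δ₀ Δ₁
∈-cutSeq⁺ {C} {A = A} A∈₀ C∈₁ with A ≟ C
... | yes refl = ∈-cutSeq⁺ʳ (C∈₁ refl) (neg-irreflexive C ∘ sym)
... | no A≢C = ∈-cutSeq⁺ˡ A∈₀ A≢C

cutSeq-≋ : ∀ {C Γ Δ₀ Δ₁} → Δ₀ ≋ (C ∷ Γ) → Δ₁ ≋ (neg C ∷ Γ) → cutSeq C Δ₀ Δ₁ ≋ Γ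
cutSeq-≋ {C} {Γ} {Δ₀} {Δ₁} (Δ₀⊆ , ⊇Δ₀) (Δ₁⊆ , ⊇Δ₁) =
  cutSeq⊆Γ , λ A∈Γ → ∈-cutSeq⁺ (⊇Δ₀ (there A∈Γ)) λ { refl → ⊇Δ₁ (there A∈Γ) }
  where
  drop : ∀ {A B} → A ∈ B ∷ Γ → A ≢ B → A ∈ Γ
  drop (here A≡B) A≢B = contradiction A≡B A≢B
  drop (there A∈Γ) _ = A∈Γ
  cutSeq⊆Γ : cutSeq C Δ₀ Δ₁ ⊆ Γ
  cutSeq⊆Γ A∈ with ∈-cutSeq⁻ A∈
  ... | inj₁ (A∈₀ , A≢C) = drop (Δ₀⊆ A∈₀) A≢C
  ... | inj₂ (A∈₁ , A≢¬C) = drop (Δ₁⊆ A∈₁) A≢¬C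

-- The role of a formula in the last inference

principal : ∀ {Γ} → Der Γ → Maybe Formula
principal (ax A _ _) = just A
principal (andI A B _ _ _ _ _ _ _) = just (A ∧ B)
principal (orI₀ A B _ _ _ _) = just (A ∨ B)
principal (orI₁ A B _ _ _ _) = just (A ∨ B)
principal (allI A _ _ _ _) = just (all A)
principal (exI A _ _ _ _ _) = just (ex A)
principal (allSI A _ _ _ _ _ _) = just (allS A)
principal (omega A _ _ _ _) = just (neg (allS A))
principal _ = nothing

active : ∀ {Γ} → Der Γ → List Formula
active (axC C _ _) = C ∷ neg C ∷ []
active d = fromMaybe (principal d)

axiom-active : ∀ {C D : Formula} {Δ} → C ∈ D ∷ neg D ∷ [] → D ∈ Δ → neg D ∈ Δ → neg C ∈ Δ
axiom-active (here refl) D∈ ¬D∈ = ¬D∈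
axiom-active {D = D} {Δ} (there (here refl)) D∈ ¬D∈ = subst (_∈ Δ) (sym (neg-involutive D)) D∈

data Role (X : Formula) {Γ} (d : Der Γ) : Set where
  side      : X ∉ active d → Role X d
  main      : principal d ≡ just X → Role X d
  axiom     : neg X ∈ Γ → Role X d

role : ∀ X {Γ} (d : Der Γ) → Role X d
role X d with X ∈? active d
... | no X∉ = side X∉
... | yes X∈ = active-role d X∈
  where
  active-role : ∀ {Γ} (d : Der Γ) → X ∈ active d → Role X d
  active-role (ax A _ _) (here refl) = main refl
  active-role (axC D D∈ ¬D∈) X∈ = axiom (axiom-active X∈ D∈ ¬D∈)
  active-role (andI A B _ _ _ _ _ _ _) (here refl) = main refl
  active-role (orI₀ A B _ _ _ _) (here refl) = main refl
  active-role (orI₁ A B _ _ _ _) (here refl) = main refl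
  active-role (allI A _ _ _ _) (here refl) = main refl
  active-role (exI A _ _ _ _ _) (here refl) = main refl
  active-role (allSI A _ _ _ _ _ _) (here refl) = main refl
  active-role (omega A _ _ _ _) (here refl) = main refl

principal-¬TRUE-neg : ∀ {Γ} (d : Der Γ) {C} → principal d ≡ just C → ¬ TRUE (neg C)
principal-¬TRUE-neg (ax A t _) refl = TRUE-neg A t
principal-¬TRUE-neg (andI A B _ _ _ _ _ _ _) refl ()
principal-¬TRUE-neg (orI₀ A B _ _ _ _) refl ()
principal-¬TRUE-neg (orI₁ A B _ _ _ _) refl ()
principal-¬TRUE-neg (allI A _ _ _ _) refl ()
principal-¬TRUE-neg (exI A _ _ _ _ _) refl ()
principal-¬TRUE-neg (allSI A _ _ _ _ _ _) refl ()
principal-¬TRUE-neg (omega A _ _ _ _) refl ()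

just-exS-injective : ∀ {A B : Body 0} → _≡_ {A = Maybe Formula} (just (exS A)) (just (exS B)) → A ≡ B
just-exS-injective refl = refl

-- Permuting a cut past a side inference

Bounded : (ℕ → Set) → ∀ {Δ Θ} → Der Δ → Der Θ → Set
Bounded H d e = ∀ m → H m → DgLe m d → DgLe m e

-- F Δ is the end-sequent to be derived from the sequent Δ of a (renamed) premise; H collects the
-- side conditions of the degree bound.
module Commute (X : Formula) (F : Seq → Seq)
  (F-keeps : ∀ {Δ A} → A ∈ Δ → A ≢ X → A ∈ F Δ)
  (F-mono : Monotone F) (H : ℕ → Set) where

  Lifted : Deriv → Set
  Lifted (Δ , d) = Σ (Der (F Δ)) (Bounded H d)

  private
    F-⊆∷ : ∀ {Δ Δ′ A} → Δ′ ⊆ A ∷ Δ → F Δ′ ⊆ A ∷ F Δ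
    F-⊆∷ = Monotone⇒⊆∷ F-mono

  freshEigen : Seq → ℕ
  freshEigen Δ = fresh (F Δ ++ Δ)

  freshEigen-notFree : ∀ Δ → NotFree (freshEigen Δ) (F Δ)
  freshEigen-notFree Δ = fresh-notFreeˡ (F Δ) Δ

  F-⊆∷-freshEigen : ∀ {Δ Δ′ Y} (A : Body 0) → NotFree Y Δ → Δ′ ⊆ inst A Y ∷ Δ →
                    F (swapSeq Y (freshEigen Δ) Δ′) ⊆ inst A (freshEigen Δ) ∷ F Δ
  F-⊆∷-freshEigen {Δ} A Y∉Δ Δ′⊆ = F-⊆∷ (⊆-swapEigen A Y∉Δ (fresh-notFreeʳ (F Δ) Δ) Δ′⊆)

  private
    F-SubΔq : ∀ {A q Δ Δ′} → SubΔq A q Δ′ Δ → SubΔq A q (F Δ′) (F Δ)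
    F-SubΔq = F-mono

    F-keeps-principal : ∀ {Δ A} → A ∈ Δ → X ∉ A ∷ [] → A ∈ F Δ
    F-keeps-principal A∈ X∉ = F-keeps A∈ (λ A≡X → X∉ (here (sym A≡X)))

  commute : ∀ {Δ} (d : Der Δ) → X ∉ active d → (∀ {p} → p ≺ (Δ , d) → Lifted p) → Lifted (Δ , d)
  commute (ax A t A∈) X∉ ih = ax A t (F-keeps-principal A∈ X∉) , λ _ _ _ → _
  commute (axC C C∈ ¬C∈) X∉ ih =
    axC C (F-keeps C∈ λ C≡X → X∉ (here (sym C≡X))) (F-keeps ¬C∈ λ ¬C≡X → X∉ (there (here (sym ¬C≡X)))) ,
    λ _ _ _ → _
  commute (andI A B A∧B∈ Δ₀ d s Δ₁ d₁ s₁) X∉ ih =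
    let e , e-dg = ih (◁⇒≺ ◁-andI₀) ; e₁ , e₁-dg = ih (◁⇒≺ ◁-andI₁) in
    andI A B (F-keeps-principal A∧B∈ X∉) _ e (F-⊆∷ s) _ e₁ (F-⊆∷ s₁) ,
    λ m h (g , g₁) → e-dg m h g , e₁-dg m h g₁
  commute (orI₀ A B A∨B∈ Δ′ d s) X∉ ih =
    let e , e-dg = ih (◁⇒≺ ◁-orI₀) in orI₀ A B (F-keeps-principal A∨B∈ X∉) _ e (F-⊆∷ s) , e-dg
  commute (orI₁ A B A∨B∈ Δ′ d s) X∉ ih =
    let e , e-dg = ih (◁⇒≺ ◁-orI₁) in orI₁ A B (F-keeps-principal A∨B∈ X∉) _ e (F-⊆∷ s) , e-dg
  commute (allI A ∀A∈ Δ′ ds s) X∉ ih =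
    allI A (F-keeps-principal ∀A∈ X∉) _ (λ n → proj₁ (ih (◁⇒≺ (◁-allI n)))) (λ n → F-⊆∷ (s n)) ,
    λ m h g n → proj₂ (ih (◁⇒≺ (◁-allI n))) m h (g n)
  commute (exI A ∃A∈ k Δ′ d s) X∉ ih =
    let e , e-dg = ih (◁⇒≺ ◁-exI) in exI A (F-keeps-principal ∃A∈ X∉) k _ e (F-⊆∷ s) , e-dg
  commute {Δ} (allSI A ∀A∈ Y Y∉Δ Δ′ d s) X∉ ih =
    let e , e-dg = ih (swap-◁⇒≺ Y (freshEigen Δ) ◁-allSI) in
    allSI A (F-keeps-principal ∀A∈ X∉) _ (freshEigen-notFree Δ) _ e (F-⊆∷-freshEigen A Y∉Δ s) ,
    λ m h g → e-dg m h (swapDer-dg Y _ m d g)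
  commute (cut C Δ₀ d s Δ₁ d₁ s₁) X∉ ih =
    let e , e-dg = ih (◁⇒≺ ◁-cut₀) ; e₁ , e₁-dg = ih (◁⇒≺ ◁-cut₁) in
    cut C _ e (F-⊆∷ s) _ e₁ (F-⊆∷ s₁) , λ m h (r , g , g₁) → r , e-dg m h g , e₁-dg m h g₁
  commute (rep Δ′ d s) X∉ ih =
    let e , e-dg = ih (◁⇒≺ ◁-rep) in rep _ e (Monotone⇒⊆ F-mono s) , e-dg
  commute (omega A ¬∀A∈ Δ′ ds s) X∉ ih =
    omega A (F-keeps-principal ¬∀A∈ X∉) _ (λ q → proj₁ (ih (◁⇒≺ (◁-omega q))))
          (λ q → F-SubΔq {A} {q} (s q)) ,
    λ m h g q → proj₂ (ih (◁⇒≺ (◁-omega q))) m h (g q)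
  commute {Δ} (omegaT A Y Y∉Δ Δ₀ d s Δ′ ds s′) X∉ ih =
    let e , e-dg = ih (swap-◁⇒≺ Y (freshEigen Δ) ◁-omegaT₀) in
    omegaT A _ (freshEigen-notFree Δ) _ e (F-⊆∷-freshEigen A Y∉Δ s)
           _ (λ q → proj₁ (ih (◁⇒≺ (◁-omegaT q)))) (λ q → F-SubΔq {A} {q} (s′ q)) ,
    λ m h (g , gs) → e-dg m h (swapDer-dg Y _ m d g) , λ q → proj₂ (ih (◁⇒≺ (◁-omegaT q))) m h (gs q)

-- Cut reduction

Reduct : Formula → Deriv → Deriv → Set
Reduct C (Δ₀ , d₀) (Δ₁ , d₁) =
  Σ (Der (cutSeq C Δ₀ Δ₁)) λ e → ∀ m → rk C ≤ m → DgLe m d₀ → DgLe m d₁ → DgLe m e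

weaken-reductˡ : ∀ {C Δ₀ Δ₁} (d₀ : Der Δ₀) (d₁ : Der Δ₁) → C ∈ Δ₁ →
                 Reduct C (Δ₀ , d₀) (Δ₁ , d₁)
weaken-reductˡ d₀ d₁ C∈₁ = rep _ d₀ (λ A∈₀ → ∈-cutSeq⁺ A∈₀ λ { refl → C∈₁ }) , λ _ _ g₀ _ → g₀

weaken-reductʳ : ∀ {C Δ₀ Δ₁} (d₀ : Der Δ₀) (d₁ : Der Δ₁) → neg C ∈ Δ₀ →
                 Reduct C (Δ₀ , d₀) (Δ₁ , d₁)
weaken-reductʳ {C} {Δ₀} {Δ₁} d₀ d₁ ¬C∈₀ = rep _ d₁ Δ₁⊆ , λ _ _ _ g₁ → g₁
  where
  Δ₁⊆ : Δ₁ ⊆ cutSeq C Δ₀ Δ₁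
  Δ₁⊆ {A} A∈₁ with A ≟ neg C
  ... | yes refl = ∈-cutSeq⁺ˡ ¬C∈₀ (neg-irreflexive C)
  ... | no A≢¬C = ∈-cutSeq⁺ʳ A∈₁ A≢¬C

module Left (C : Formula) ((Δ₁ , d₁) : Deriv) =
  Commute C (λ Δ → cutSeq C Δ Δ₁) ∈-cutSeq⁺ˡ cutSeq-monoˡ (λ m → rk C ≤ m × DgLe m d₁)

module Right (C : Formula) ((Δ₀ , d₀) : Deriv) =
  Commute (neg C) (cutSeq C Δ₀) ∈-cutSeq⁺ʳ cutSeq-monoʳ (λ m → rk C ≤ m × DgLe m d₀)

module _ (C : Formula) (D₀ D₁ : Deriv) where

  Reduct⇒Liftedˡ : Reduct C D₀ D₁ → Left.Lifted C D₁ D₀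
  Reduct⇒Liftedˡ (e , e-dg) = e , λ m (r , g₁) g₀ → e-dg m r g₀ g₁

  Liftedˡ⇒Reduct : Left.Lifted C D₁ D₀ → Reduct C D₀ D₁
  Liftedˡ⇒Reduct (e , e-dg) = e , λ m r g₀ g₁ → e-dg m (r , g₁) g₀

  Reduct⇒Liftedʳ : Reduct C D₀ D₁ → Right.Lifted C D₀ D₁
  Reduct⇒Liftedʳ (e , e-dg) = e , λ m (r , g₀) g₁ → e-dg m r g₀ g₁

  Liftedʳ⇒Reduct : Right.Lifted C D₀ D₁ → Reduct C D₀ D₁
  Liftedʳ⇒Reduct (e , e-dg) = e , λ m r g₀ g₁ → e-dg m (r , g₀) g₁

principal-cut : ∀ C ((Δ₀ , d₀) (Δ₁ , d₁) : Deriv) {p₀ p₁} (A : Formula) →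
                (∀ {m} → rk C ≤ m → suc (rk A) ≤ m) →
                p₀ ◁ (Δ₀ , d₀) → p₁ ◁ (Δ₁ , d₁) → proj₁ p₀ ⊆ A ∷ Δ₀ → proj₁ p₁ ⊆ neg A ∷ Δ₁ →
                Reduct C p₀ (Δ₁ , d₁) → Reduct C (Δ₀ , d₀) p₁ → Reduct C (Δ₀ , d₀) (Δ₁ , d₁)
principal-cut C _ _ A rank p₀◁ p₁◁ p₀⊆ p₁⊆ (e₀ , e₀-dg) (e₁ , e₁-dg) =
  cut A _ e₀ (Monotone⇒⊆∷ cutSeq-monoˡ p₀⊆) _ e₁ (Monotone⇒⊆∷ cutSeq-monoʳ p₁⊆) ,
  λ m r g₀ g₁ → rank r , e₀-dg m r (◁-dg p₀◁ g₀) g₁ , e₁-dg m r g₀ (◁-dg p₁◁ g₁)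

mutual
  reduct : ∀ C D₀ D₁ → Acc _⊏_ (D₀ , D₁) → Reduct C D₀ D₁
  reduct C D₀@(Δ₀ , d₀) D₁@(Δ₁ , d₁) acc⊏ with role C d₀
  ... | side C∉ = reduct-sideˡ C D₀ D₁ acc⊏ C∉
  ... | axiom ¬C∈₀ = weaken-reductʳ d₀ d₁ ¬C∈₀
  ... | main C-main with role (neg C) d₁
  ...   | side ¬C∉ = reduct-sideʳ C D₀ D₁ acc⊏ ¬C∉
  ...   | axiom ¬¬C∈₁ = weaken-reductˡ d₀ d₁ (subst (_∈ Δ₁) (neg-involutive C) ¬¬C∈₁)
  ...   | main ¬C-main = reduct-principal C D₀ D₁ acc⊏ C-main ¬C-main

  reduct-sideˡ : ∀ C D₀ D₁ → Acc _⊏_ (D₀ , D₁) → C ∉ active (proj₂ D₀) → Reduct C D₀ D₁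
  reduct-sideˡ C D₀@(_ , d₀) D₁ (acc rs) C∉ =
    Liftedˡ⇒Reduct C D₀ D₁ (Left.commute C D₁ d₀ C∉ λ {p} p≺ →
      Reduct⇒Liftedˡ C p D₁ (reduct C p D₁ (rs (inj₁ p≺))))

  reduct-sideʳ : ∀ C D₀ D₁ → Acc _⊏_ (D₀ , D₁) → neg C ∉ active (proj₂ D₁) → Reduct C D₀ D₁
  reduct-sideʳ C D₀ D₁@(_ , d₁) (acc rs) ¬C∉ =
    Liftedʳ⇒Reduct C D₀ D₁ (Right.commute C D₀ d₁ ¬C∉ λ {p} p≺ →
      Reduct⇒Liftedʳ C D₀ p (reduct C D₀ p (rs (inj₂ (refl , p≺)))))

  reduct-principal : ∀ C D₀ D₁ → Acc _⊏_ (D₀ , D₁) →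
                     principal (proj₂ D₀) ≡ just C → principal (proj₂ D₁) ≡ just (neg C) →
                     Reduct C D₀ D₁
  reduct-principal C D₀@(_ , andI A B _ _ _ sa _ _ _) D₁@(_ , orI₀ _ _ _ _ _ sf) (acc rs) refl refl =
    principal-cut C D₀ D₁ A (≤-trans (s≤s (m≤m⊔n _ _))) ◁-andI₀ ◁-orI₀ sa sf
      (reduct C _ D₁ (rs (inj₁ (◁⇒≺ ◁-andI₀)))) (reduct C D₀ _ (rs (inj₂ (refl , ◁⇒≺ ◁-orI₀))))
  reduct-principal C D₀@(_ , andI A B _ _ _ _ _ _ sb) D₁@(_ , orI₁ _ _ _ _ _ sf) (acc rs) refl refl =
    principal-cut C D₀ D₁ B (≤-trans (s≤s (m≤n⊔m _ _))) ◁-andI₁ ◁-orI₁ sb sf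
      (reduct C _ D₁ (rs (inj₁ (◁⇒≺ ◁-andI₁)))) (reduct C D₀ _ (rs (inj₂ (refl , ◁⇒≺ ◁-orI₁))))
  reduct-principal C D₀@(_ , orI₀ A B _ _ _ sa) D₁@(_ , andI _ _ _ _ _ sf _ _ _) (acc rs) refl refl =
    principal-cut C D₀ D₁ A (≤-trans (s≤s (m≤m⊔n _ _))) ◁-orI₀ ◁-andI₀ sa sf
      (reduct C _ D₁ (rs (inj₁ (◁⇒≺ ◁-orI₀)))) (reduct C D₀ _ (rs (inj₂ (refl , ◁⇒≺ ◁-andI₀))))
  reduct-principal C D₀@(_ , orI₁ A B _ _ _ sb) D₁@(_ , andI _ _ _ _ _ _ _ _ sf) (acc rs) refl refl =
    principal-cut C D₀ D₁ B (≤-trans (s≤s (m≤n⊔m _ _))) ◁-orI₁ ◁-andI₁ sb sf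
      (reduct C _ D₁ (rs (inj₁ (◁⇒≺ ◁-orI₁)))) (reduct C D₀ _ (rs (inj₂ (refl , ◁⇒≺ ◁-andI₁))))
  reduct-principal C D₀@(_ , allI A _ _ _ sa) D₁@(Δ₁ , exI _ _ k Δf _ sf) (acc rs) refl refl =
    principal-cut C D₀ D₁ (A [ k ]) (subst (λ n → suc n ≤ _) (sym (rk-substF _ k A))) (◁-allI k) ◁-exI
      (sa k) (subst (λ B → Δf ⊆ B ∷ Δ₁) (sym (neg-substF _ k A)) sf)
      (reduct C _ D₁ (rs (inj₁ (◁⇒≺ (◁-allI k))))) (reduct C D₀ _ (rs (inj₂ (refl , ◁⇒≺ ◁-exI))))
  reduct-principal C D₀@(_ , exI A _ k _ _ sa) D₁@(Δ₁ , allI _ _ Δf _ sf) (acc rs) refl refl =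
    principal-cut C D₀ D₁ (A [ k ]) (subst (λ n → suc n ≤ _) (sym (rk-substF _ k A))) ◁-exI (◁-allI k)
      sa (subst (λ B → Δf k ⊆ B ∷ Δ₁) (sym (neg-substF _ k A)) (sf k))
      (reduct C _ D₁ (rs (inj₁ (◁⇒≺ ◁-exI)))) (reduct C D₀ _ (rs (inj₂ (refl , ◁⇒≺ (◁-allI k)))))
  reduct-principal C D₀@(Δ₀ , allSI A _ Y Y∉Δ₀ Δa a sa) D₁@(Δ₁ , omega _ _ Δf fs sf) (acc rs) refl ¬C-main
    -- ¬C-main equates ∃X ¬A′ with ∃X ¬A (A′ the Ω-formula); A′ = A needs injectivity of negB.
    with refl ← negB-injective (just-exS-injective ¬C-main) =
    omegaT A Z (Left.freshEigen-notFree C D₁ Δ₀)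
           _ (proj₁ renamed) (Left.F-⊆∷-freshEigen C D₁ A Y∉Δ₀ sa)
           _ (λ q → proj₁ (premise q)) (λ q → cutSeq-monoʳ {C} {Δ₀} (sf q)) ,
    λ m r g₀ g₁ → proj₂ renamed m r (swapDer-dg Y Z m a g₀) g₁ ,
                  λ q → proj₂ (premise q) m r g₀ (g₁ q)
    where
    Z : ℕ
    Z = Left.freshEigen C D₁ Δ₀
    renamed : Reduct C (swapDeriv Y Z (Δa , a)) D₁
    renamed = reduct C _ D₁ (rs (inj₁ (swap-◁⇒≺ Y Z ◁-allSI)))
    premise : ∀ q → Reduct C D₀ (Δf q , fs q)
    premise q = reduct C D₀ _ (rs (inj₂ (refl , ◁⇒≺ (◁-omega q))))
  reduct-principal C D₀@(Δ₀ , omega A _ Δa as sa) D₁@(Δ₁ , allSI _ _ Y Y∉Δ₁ Δf f sf) (acc rs) refl refl =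
    omegaT A Z (Right.freshEigen-notFree C D₀ Δ₁) _ (proj₁ renamed)
           (subst (λ B → cutSeq C Δ₀ (swapSeq Y Z Δf) ⊆ inst B Z ∷ cutSeq C Δ₀ Δ₁) (negB-involutive A)
                  (Right.F-⊆∷-freshEigen C D₀ _ Y∉Δ₁ sf))
           _ (λ q → proj₁ (premise q)) (λ q → cutSeq-monoˡ {C} {Δ₁} (sa q)) ,
    λ m r g₀ g₁ → proj₂ renamed m r g₀ (swapDer-dg Y Z m f g₁) ,
                  λ q → proj₂ (premise q) m r (g₀ q) g₁
    where
    Z : ℕ
    Z = Right.freshEigen C D₀ Δ₁
    renamed : Reduct C D₀ (swapDeriv Y Z (Δf , f))
    renamed = reduct C D₀ _ (rs (inj₂ (refl , swap-◁⇒≺ Y Z ◁-allSI)))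
    premise : ∀ q → Reduct C (Δa q , as q) D₁
    premise q = reduct C _ D₁ (rs (inj₁ (◁⇒≺ (◁-omega q))))
  reduct-principal C (Δ₀ , d₀) (Δ₁ , ax _ t _) _ C-main refl =
    ⊥-elim (principal-¬TRUE-neg d₀ C-main t)
  reduct-principal C (Δ₀ , ax _ t _) (Δ₁ , d₁) _ refl ¬C-main =
    ⊥-elim (principal-¬TRUE-neg d₁ ¬C-main (subst TRUE (sym (neg-involutive C)) t))

cutReduct : Formula → Deriv → Deriv → Deriv
cutReduct C D₀ D₁ = cutSeq C (proj₁ D₀) (proj₁ D₁) , proj₁ (reduct C D₀ D₁ (⊏-wellFounded _))

theorem1 : Σ (Formula → Deriv → Deriv → Deriv) (λ R → (m : ℕ) (Γ : Seq) (C : Formula) → rk C ≤ m → (d₀ d₁ : Deriv) → d₀ ⊢[ m ] (C ∷ Γ) → d₁ ⊢[ m ] (neg C ∷ Γ) → R C d₀ d₁ ⊢[ m ] Γ)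
theorem1 = cutReduct , λ m Γ C rkC≤m d₀ d₁ (≋₀ , g₀) (≋₁ , g₁) →
  cutSeq-≋ ≋₀ ≋₁ , proj₂ (reduct C d₀ d₁ (⊏-wellFounded _)) m rkC≤m g₀ g₁
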